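{- If $G$ is a connected graph on $n\ge2$ vertices such that its Laplacian simplex $T_G$ is $2$-reflexive, then the Laplacian simplex $T_{W(G)}$ of its whiskered graph is reflexive.
   Context: The Laplacian $L$ of a graph on $[m]$ has $L_{ii}=\deg(i)$, $L_{ij}=-1$ if $\{i,j\}$ is an edge and $0$ otherwise. Let $A$ be the $m\times(m-1)$ matrix with $a_{ij}=1$ if $i\le j\le m-1$ and $0$ otherwise; $L_B=LA$. The Laplacian simplex $T_G\subseteq\mathbb{R}^{m-1}$ is the convex hull of the rows of $L_B$. A full-dimensional lattice polytope $P$ is reflexive if it contains the origin in its interior and its dual $\{x:x\cdot y\le1\ \forall y\in P\}$ is a lattice polytope. For a positive integer $\ell$, $P$ is $\ell$-reflexive if it contains the origin in its interior, its vertices are primitive (no lattice point other than the endpoints on the segment from the origin to a vertex), and every facet lies at lattice distance exactly $\ell$ from the origin. The whiskered graph $W(G)$ of $G$ with vertices $x_1,\dots,x_n$ is obtained by adding new vertices $y_1,\dots,y_n$ and edges $\{x_i,y_i\}$. -}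

module Defs where

open import Data.Bool using (Bool; true; false; if_then_else_)
open import Data.Nat as ℕ using (ℕ; zero; suc; _≤ᵇ_)
open import Data.Integer as ℤ using (ℤ; +_)
open import Data.Rational as ℚ using (ℚ; 0ℚ; 1ℚ)
open import Data.Fin using (Fin; zero; suc; toℕ; splitAt)
open import Data.Fin.Properties using (_≟_)
open import Data.Sum using (_⊎_; inj₁; inj₂)
open import Data.Product using (Σ; ∃; _×_; _,_)
open import Function.Bundles using (_⇔_)
open import Relation.Nullary using (¬_; does)
open import Relation.Nullary.Decidable using (⌊_⌋)
open import Relation.Binary.PropositionalEquality using (_≡_; refl)

sumℤ : ∀ {n} → (Fin n → ℤ) → ℤ
sumℤ {zero}  f = + 0
sumℤ {suc n} f = f zero ℤ.+ sumℤ (λ i → f (suc i))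

sumℚ : ∀ {n} → (Fin n → ℚ) → ℚ
sumℚ {zero}  f = 0ℚ
sumℚ {suc n} f = f zero ℚ.+ sumℚ (λ i → f (suc i))

record Graph (m : ℕ) : Set where
  field
    adj    : Fin m → Fin m → Bool
    sym    : ∀ i j → adj i j ≡ adj j i
    irrefl : ∀ i → adj i i ≡ false
open Graph public

data Reach {m} (G : Graph m) : Fin m → Fin m → Set where
  here : ∀ {i} → Reach G i i
  step : ∀ {i k j} → adj G i k ≡ true → Reach G k j → Reach G i j

Connected : ∀ {m} → Graph m → Set
Connected G = ∀ i j → Reach G i j

degree : ∀ {m} → Graph m → Fin m → ℤ
degree G i = sumℤ (λ j → if adj G i j then + 1 else + 0)

laplacian : ∀ {m} → Graph m → Fin m → Fin m → ℤ
laplacian G i j =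
  if ⌊ i ≟ j ⌋ then degree G i
  else (if adj G i j then ℤ.- (+ 1) else + 0)

-- A : m × (m-1) matrix, a_{kj} = 1 iff k ≤ j (1-based; same with 0-based)
matA : ∀ {d} → Fin (suc d) → Fin d → ℤ
matA k j = if toℕ k ≤ᵇ toℕ j then + 1 else + 0

laplacianB : ∀ {d} → Graph (suc d) → Fin (suc d) → Fin d → ℤ
laplacianB G i j = sumℤ (λ k → laplacian G i k ℤ.* matA k j)

-- T_G, given by its list of (candidate) vertices: the rows of L_B
laplacianSimplex : ∀ {d} → Graph (suc d) → Fin (suc d) → Fin d → ℤ
laplacianSimplex G = laplacianB G

-- Whiskered graph: vertices x_1..x_n are Fin n embedded on the left,
-- y_1..y_n are the right copy of Fin n in Fin (n + n).

whiskerAdj : ∀ {n} → Graph n → Fin (n ℕ.+ n) → Fin (n ℕ.+ n) → Bool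
whiskerAdj {n} G u v with splitAt n u | splitAt n v
... | inj₁ i | inj₁ j = adj G i j
... | inj₁ i | inj₂ j = ⌊ i ≟ j ⌋
... | inj₂ i | inj₁ j = ⌊ i ≟ j ⌋
... | inj₂ i | inj₂ j = false

private
  ≟-sym : ∀ {n} (i j : Fin n) → ⌊ i ≟ j ⌋ ≡ ⌊ j ≟ i ⌋
  ≟-sym i j with i ≟ j | j ≟ i
  ... | Relation.Nullary.yes _ | Relation.Nullary.yes _ = refl
  ... | Relation.Nullary.no _  | Relation.Nullary.no _  = refl
  ... | Relation.Nullary.yes refl | Relation.Nullary.no q = Data.Empty.⊥-elim (q refl)
    where import Data.Empty
  ... | Relation.Nullary.no p | Relation.Nullary.yes refl = Data.Empty.⊥-elim (p refl)
    where import Data.Empty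

  whiskerSym : ∀ {n} (G : Graph n) u v → whiskerAdj G u v ≡ whiskerAdj G v u
  whiskerSym {n} G u v with splitAt n u | splitAt n v
  ... | inj₁ i | inj₁ j = sym G i j
  ... | inj₁ i | inj₂ j = ≟-sym i j
  ... | inj₂ i | inj₁ j = ≟-sym i j
  ... | inj₂ i | inj₂ j = refl

  whiskerIrr : ∀ {n} (G : Graph n) u → whiskerAdj G u u ≡ false
  whiskerIrr {n} G u with splitAt n u
  ... | inj₁ i = irrefl G i
  ... | inj₂ i = refl

whisker : ∀ {n} → Graph n → Graph (n ℕ.+ n)
whisker G = record { adj = whiskerAdj G ; sym = whiskerSym G ; irrefl = whiskerIrr G }

Point : ℕ → Set
Point d = Fin d → ℚ

toℚ : ℤ → ℚ
toℚ z = z ℚ./ 1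

embed : ∀ {d} → (Fin d → ℤ) → Point d
embed v c = toℚ (v c)

dot : ∀ {d} → Point d → Point d → ℚ
dot x y = sumℚ (λ c → x c ℚ.* y c)

IsLatticePoint : ∀ {d} → Point d → Set
IsLatticePoint x = ∀ c → ∃ λ (z : ℤ) → x c ≡ toℚ z

InConv : ∀ {k d} → (Fin k → Fin d → ℤ) → Point d → Set
InConv {k} V x = Σ (Fin k → ℚ) λ λs →
  (∀ i → 0ℚ ℚ.≤ λs i) × sumℚ λs ≡ 1ℚ ×
  (∀ c → x c ≡ sumℚ (λ i → λs i ℚ.* toℚ (V i c)))

OriginInInterior : ∀ {k d} → (Fin k → Fin d → ℤ) → Set
OriginInInterior {d = d} V = Σ ℚ λ ε → 0ℚ ℚ.< ε ×
  (∀ (x : Point d) → (∀ c → (ℚ.- ε) ℚ.≤ x c × x c ℚ.≤ ε) → InConv V x)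

InDual : ∀ {k d} → (Fin k → Fin d → ℤ) → Point d → Set
InDual V x = ∀ y → InConv V y → dot x y ℚ.≤ 1ℚ

DualIsLatticePolytope : ∀ {k d} → (Fin k → Fin d → ℤ) → Set
DualIsLatticePolytope {d = d} V =
  Σ ℕ λ k' → Σ (Fin k' → Fin d → ℤ) λ W → ∀ (x : Point d) → InDual V x ⇔ InConv W x

IsReflexive : ∀ {k d} → (Fin k → Fin d → ℤ) → Set
IsReflexive V = OriginInInterior V × DualIsLatticePolytope V

IsVertex : ∀ {k d} → (Fin k → Fin d → ℤ) → Point d → Set
IsVertex V v = InConv V v ×
  (∀ y z (t : ℚ) → InConv V y → InConv V z → 0ℚ ℚ.< t → t ℚ.< 1ℚ →
     (∀ c → v c ≡ t ℚ.* y c ℚ.+ (1ℚ ℚ.- t) ℚ.* z c) → ∀ c → y c ≡ z c)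

IsPrimitive : ∀ {d} → Point d → Set
IsPrimitive v = IsLatticePoint v ×
  (∀ (t : ℚ) → 0ℚ ℚ.< t → t ℚ.< 1ℚ → ¬ IsLatticePoint (λ c → t ℚ.* v c))

AffinelyIndependent : ∀ {r d} → (Fin r → Point d) → Set
AffinelyIndependent {r} p = ∀ (μ : Fin r → ℚ) → sumℚ μ ≡ 0ℚ →
  (∀ c → sumℚ (λ i → μ i ℚ.* p i c) ≡ 0ℚ) → ∀ i → μ i ≡ 0ℚ

-- {x : a·x = b} is the affine hull of a facet of P = conv V ⊆ ℚ^d:
-- a·x ≤ b is valid on P and P ∩ {a·x = b} contains d affinely
-- independent points (i.e. the face has dimension d-1)
IsFacetHyperplane : ∀ {k d} → (Fin k → Fin d → ℤ) → Point d → ℚ → Set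
IsFacetHyperplane {d = d} V a b =
  (∀ x → InConv V x → dot a x ℚ.≤ b) ×
  Σ (Fin d → Point d) λ p →
    (∀ i → InConv V (p i)) × (∀ i → dot a (p i) ≡ b) × AffinelyIndependent p

-- ℓ-reflexive: origin in the interior, primitive vertices, and every facet
-- at lattice distance ℓ from the origin (the facet lies in {a·x = b} with
-- a primitive integral normal a, and its lattice distance is b)
IsLReflexive : ∀ {k d} → (Fin k → Fin d → ℤ) → ℕ → Set
IsLReflexive V ℓ = OriginInInterior V ×
  (∀ v → IsVertex V v → IsPrimitive v) ×
  (∀ a b → IsPrimitive a → IsFacetHyperplane V a b → b ≡ toℚ (+ ℓ))

module Submission where

-- The vertices of T_H are the rows V_i of L A.  For a vector u on the
-- vertices let Du = (u_c - u_{c+1})_c; since A telescopes, Du · V_i = (L u)_i.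
-- After basic facts on sums, the Laplacian and A, the file shows:
--   * the V_i span ℚ^d iff L u = t is solvable for all t with Σ t = 0; the
--     origin being interior to T_G gives the former, and solvability passes
--     from G to W(G);
--   * a reflexivity criterion: if the V_i span and sum to 0, and lattice
--     points W_j satisfy W_j · V_i = 1 - n δ_ij, then conv V is reflexive
--     with dual conv W.  Such W_j are D u_j for integral "potentials" u_j
--     with L u_j = 1 - n e_j;
--   * the solutions w_j of w_j · V_i = 1 - n δ_ij are facet normals of T_G;
--     2-reflexivity forces 2 w_j to be integral, giving integral potentials
--     U_j of G with L U_j = 2 (1 - n e_j);
--   * on W(G) (2n vertices) the potential of a vertex v is assembled from
--     U_{base v}, so W(G) has integral potentials and T_{W(G)} is reflexive.

open import Data.Bool using (Bool; true; false; if_then_else_; T)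
open import Data.Unit using (tt)
open import Data.Empty using (⊥; ⊥-elim)
open import Data.Nat as ℕ using (ℕ; zero; suc; _≤ᵇ_)
import Data.Nat.Properties as ℕP
import Data.Nat.Divisibility as ℕD
import Data.Nat.Coprimality as ℕC
import Data.Nat.GCD as ℕG
open import Data.Integer as ℤ using (ℤ; +_; -[1+_])
import Data.Integer.Properties as ℤP
import Data.Integer.GCD as ℤG
import Data.Integer.Divisibility.Signed as ℤS
open import Data.Rational as ℚ
  using (ℚ; mkℚ; 0ℚ; 1ℚ; _+_; _*_; _-_; -_; _≤_; _<_; ↥_; ↧_; ↧ₙ_)
import Data.Rational.Properties as ℚP
import Data.Rational.Unnormalised as ℚᵘ
import Data.Rational.Unnormalised.Properties as ℚᵘP
open import Data.Rational.Solver using (module +-*-Solver)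
open import Data.Fin using (Fin; zero; suc; toℕ; inject₁; fromℕ; punchIn; _↑ˡ_; _↑ʳ_; splitAt)
import Data.Fin.Properties as FinP
open import Data.Fin.Properties using (_≟_)
open import Data.Product using (Σ; _,_; proj₁; proj₂; _×_)
open import Data.Sum using (_⊎_; inj₁; inj₂; [_,_]′)
open import Function.Bundles using (mk⇔)
open import Relation.Nullary using (Dec; yes; no; ¬_)
open import Relation.Nullary.Decidable using (⌊_⌋)
open import Relation.Binary.Definitions using (tri<; tri≈; tri>)
open import Relation.Binary.PropositionalEquality
open ≡-Reasoning
open import Defs hiding (sym)

open +-*-Solver

ℚ-ext : ∀ (p q : ℚ) → ↥ p ≡ ↥ q → ↧ₙ p ≡ ↧ₙ q → p ≡ q
ℚ-ext (mkℚ n d c) (mkℚ .n .d c') refl refl = refl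

canon : ℤ → ℚ
canon z = mkℚ z 0 (ℕC.sym (ℕC.1-coprimeTo _))

toℚ-canon : ∀ z → toℚ z ≡ canon z
toℚ-canon z = ℚ-ext (toℚ z) (canon z) num (cong ℤ.∣_∣ den)
  where
  g1 : ℤG.gcd z (+ 1) ≡ + 1
  g1 = cong +_ (ℕG.gcd-zeroʳ ℤ.∣ z ∣)
  num : ↥ toℚ z ≡ z
  num = trans (sym (ℤP.*-identityʳ _)) (trans (cong ((↥ toℚ z) ℤ.*_) (sym g1)) (ℚP.↥-/ z 1))
  den : ↧ toℚ z ≡ + 1
  den = trans (sym (ℤP.*-identityʳ _)) (trans (cong ((↧ toℚ z) ℤ.*_) (sym g1)) (ℚP.↧-/ z 1))

toℚ-+ : ∀ a b → toℚ (a ℤ.+ b) ≡ toℚ a + toℚ b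
toℚ-+ a b rewrite toℚ-canon a | toℚ-canon b =
  cong toℚ (cong₂ ℤ._+_ (sym (ℤP.*-identityʳ a)) (sym (ℤP.*-identityʳ b)))

toℚ-* : ∀ a b → toℚ (a ℤ.* b) ≡ toℚ a * toℚ b
toℚ-* a b rewrite toℚ-canon a | toℚ-canon b = refl

toℚ-neg : ∀ a → toℚ (ℤ.- a) ≡ - toℚ a
toℚ-neg a rewrite toℚ-canon a | toℚ-canon (ℤ.- a) =
  ℚ-ext _ _ (sym (ℚP.↥-neg (canon a))) (cong ℤ.∣_∣ (sym (ℚP.↧-neg (canon a))))

toℚ-inj : ∀ {a b} → toℚ a ≡ toℚ b → a ≡ b
toℚ-inj {a} {b} eq = cong ↥_ (trans (sym (toℚ-canon a)) (trans eq (toℚ-canon b)))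

ℕtoℚ : ℕ → ℚ
ℕtoℚ n = toℚ (+ n)

ℕtoℚ-suc : ∀ n → ℕtoℚ (suc n) ≡ 1ℚ + ℕtoℚ n
ℕtoℚ-suc n = toℚ-+ (+ 1) (+ n)

ℕtoℚ-* : ∀ a b → ℕtoℚ (a ℕ.* b) ≡ ℕtoℚ a * ℕtoℚ b
ℕtoℚ-* a b = trans (cong toℚ (ℤP.pos-* a b)) (toℚ-* (+ a) (+ b))

*-denominator : ∀ (p : ℚ) → p * ℕtoℚ (↧ₙ p) ≡ toℚ (↥ p)
*-denominator p@(mkℚ n d c) rewrite toℚ-canon (+ suc d) | toℚ-canon n =
  ℚP.toℚᵘ-injective (ℚᵘP.≃-trans (ℚP.toℚᵘ-homo-* p (canon (+ suc d))) (ℚᵘ.*≡* (ℤP.*-assoc n (+ suc d) (+ 1))))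

-- The reciprocal 1/(n+1) of a positive integer.
recip : ℕ → ℚ
recip n = ℚ.1/ canon (+ suc n)

recip-inverse : ∀ n → ℕtoℚ (suc n) * recip n ≡ 1ℚ
recip-inverse n rewrite toℚ-canon (+ suc n) = ℚP.*-inverseʳ (canon (+ suc n))

suc-cancel : ∀ n {x} → ℕtoℚ (suc n) * x ≡ 0ℚ → x ≡ 0ℚ
suc-cancel n {x} e = begin
  x                                ≡⟨ sym (ℚP.*-identityˡ x) ⟩
  1ℚ * x                           ≡⟨ cong (_* x) (sym (trans (ℚP.*-comm (recip n) (ℕtoℚ (suc n))) (recip-inverse n))) ⟩
  recip n * ℕtoℚ (suc n) * x       ≡⟨ ℚP.*-assoc (recip n) (ℕtoℚ (suc n)) x ⟩
  recip n * (ℕtoℚ (suc n) * x)     ≡⟨ cong (recip n *_) e ⟩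
  recip n * 0ℚ                     ≡⟨ ℚP.*-zeroʳ (recip n) ⟩
  0ℚ                               ∎

a-b≡0⇒a≡b : ∀ {a b : ℚ} → a - b ≡ 0ℚ → a ≡ b
a-b≡0⇒a≡b {a} {b} e = trans (solve 2 (λ a b → a := a :- b :+ b) refl a b) (trans (cong (_+ b) e) (ℚP.+-identityˡ b))

IsInt : ℚ → Set
IsInt q = Σ ℤ (λ z → q ≡ toℚ z)

int-+ : ∀ {a b} → IsInt a → IsInt b → IsInt (a + b)
int-+ (x , ex) (y , ey) = x ℤ.+ y , trans (cong₂ _+_ ex ey) (sym (toℚ-+ x y))

int-* : ∀ {a b} → IsInt a → IsInt b → IsInt (a * b)
int-* (x , ex) (y , ey) = x ℤ.* y , trans (cong₂ _*_ ex ey) (sym (toℚ-* x y))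

int-- : ∀ {a b} → IsInt a → IsInt b → IsInt (a - b)
int-- ia (y , ey) = int-+ ia (ℤ.- y , trans (cong -_ ey) (sym (toℚ-neg y)))

int-sum : ∀ {n} (f : Fin n → ℚ) → (∀ i → IsInt (f i)) → IsInt (sumℚ f)
int-sum {zero} f h = + 0 , refl
int-sum {suc n} f h = int-+ (h zero) (int-sum (λ i → f (suc i)) (λ i → h (suc i)))

bq : Bool → ℚ
bq b = if b then 1ℚ else 0ℚ

int-bq : ∀ b → IsInt (bq b)
int-bq true = + 1 , refl
int-bq false = + 0 , refl

toℚ-bool : ∀ b → toℚ (if b then + 1 else + 0) ≡ bq b
toℚ-bool true = refl
toℚ-bool false = refl

0≤1 : 0ℚ ≤ 1ℚ
0≤1 = ℚ.*≤* (ℤ.+≤+ ℕ.z≤n)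

0≤+ : ∀ {a b} → 0ℚ ≤ a → 0ℚ ≤ b → 0ℚ ≤ a + b
0≤+ = ℚP.+-mono-≤

0≤* : ∀ {a b} → 0ℚ ≤ a → 0ℚ ≤ b → 0ℚ ≤ a * b
0≤* {a} {b} ha hb =
  ℚP.nonNegative⁻¹ (a * b) {{ℚP.nonNeg*nonNeg⇒nonNeg a {{ℚ.nonNegative ha}} b {{ℚ.nonNegative hb}}}}

≤⇒0≤- : ∀ {p q} → p ≤ q → 0ℚ ≤ q - p
≤⇒0≤- {p} {q} h = ℚP.≤-trans (ℚP.≤-reflexive (sym (ℚP.+-inverseʳ p))) (ℚP.+-monoˡ-≤ (- p) h)

0≤-⇒≤ : ∀ {p q} → 0ℚ ≤ q - p → p ≤ q
0≤-⇒≤ {p} {q} h = ℚP.≤-trans (ℚP.≤-reflexive (sym (ℚP.+-identityˡ p)))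
  (ℚP.≤-trans (ℚP.+-monoˡ-≤ p h) (ℚP.≤-reflexive (solve 2 (λ p q → q :- p :+ p := q) refl p q)))

≤-via : ∀ {p q r} → r ≡ q - p → 0ℚ ≤ r → p ≤ q
≤-via refl = 0≤-⇒≤

0≤ℕ : ∀ n → 0ℚ ≤ ℕtoℚ n
0≤ℕ zero = ℚP.≤-refl
0≤ℕ (suc n) = subst (0ℚ ≤_) (sym (ℕtoℚ-suc n)) (0≤+ 0≤1 (0≤ℕ n))

recip-nonneg : ∀ n → 0ℚ ≤ recip n
recip-nonneg n = ℚ.*≤* (ℤ.+≤+ ℕ.z≤n)

absq : ℤ → ℚ
absq w = ℕtoℚ ℤ.∣ w ∣

absbound : ∀ (w : ℤ) {x ε : ℚ} → - ε ≤ x → x ≤ ε → toℚ w * x ≤ absq w * ε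
absbound (+ n) {x} {ε} h1 h2 =
  ≤-via (solve 3 (λ a x e → a :* (e :- x) := a :* e :- a :* x) refl (ℕtoℚ n) x ε)
        (0≤* (0≤ℕ n) (≤⇒0≤- h2))
absbound -[1+ n ] {x} {ε} h1 h2 =
  ≤-via (trans (solve 3 (λ a x e → a :* (x :- (:- e)) := a :* e :- (:- a) :* x) refl (ℕtoℚ (suc n)) x ε)
               (cong (λ z → ℕtoℚ (suc n) * ε - z * x) (sym (toℚ-neg (+ suc n)))))
        (0≤* (0≤ℕ (suc n)) (≤⇒0≤- h1))

sum-cong : ∀ {n} {f g : Fin n → ℚ} → (∀ i → f i ≡ g i) → sumℚ f ≡ sumℚ g
sum-cong {zero} h = refl
sum-cong {suc n} h = cong₂ _+_ (h zero) (sum-cong (λ i → h (suc i)))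

sum-0 : ∀ {n} → sumℚ {n} (λ _ → 0ℚ) ≡ 0ℚ
sum-0 {zero} = refl
sum-0 {suc n} = cong (_+_ 0ℚ) (sum-0 {n})

sum-+ : ∀ {n} (f g : Fin n → ℚ) → sumℚ (λ i → f i + g i) ≡ sumℚ f + sumℚ g
sum-+ {zero} f g = refl
sum-+ {suc n} f g =
  trans (cong (_+_ (f zero + g zero)) (sum-+ (λ i → f (suc i)) (λ i → g (suc i))))
        (solve 4 (λ a b c d → (a :+ b) :+ (c :+ d) := (a :+ c) :+ (b :+ d)) refl
               (f zero) (g zero) (sumℚ (λ i → f (suc i))) (sumℚ (λ i → g (suc i))))

sum-*l : ∀ {n} (c : ℚ) (f : Fin n → ℚ) → sumℚ (λ i → c * f i) ≡ c * sumℚ f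
sum-*l {zero} c f = sym (ℚP.*-zeroʳ c)
sum-*l {suc n} c f = trans (cong (_+_ (c * f zero)) (sum-*l c (λ i → f (suc i)))) (sym (ℚP.*-distribˡ-+ c _ _))

sum-*r : ∀ {n} (c : ℚ) (f : Fin n → ℚ) → sumℚ (λ i → f i * c) ≡ sumℚ f * c
sum-*r c f = trans (sum-cong (λ i → ℚP.*-comm (f i) c)) (trans (sum-*l c f) (ℚP.*-comm c _))

sum-neg : ∀ {n} (f : Fin n → ℚ) → sumℚ (λ i → - f i) ≡ - sumℚ f
sum-neg {zero} f = refl
sum-neg {suc n} f = trans (cong (_+_ (- f zero)) (sum-neg (λ i → f (suc i)))) (sym (ℚP.neg-distrib-+ (f zero) _))

sum-- : ∀ {n} (f g : Fin n → ℚ) → sumℚ (λ i → f i - g i) ≡ sumℚ f - sumℚ g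
sum-- f g = trans (sum-+ f (λ i → - g i)) (cong (_+_ (sumℚ f)) (sum-neg g))

sum-swap : ∀ {m n} (f : Fin m → Fin n → ℚ) →
  sumℚ (λ i → sumℚ (λ j → f i j)) ≡ sumℚ (λ j → sumℚ (λ i → f i j))
sum-swap {zero} {n} f = sym (sum-0 {n})
sum-swap {suc m} {n} f =
  trans (cong (_+_ (sumℚ (λ j → f zero j))) (sum-swap (λ i j → f (suc i) j)))
        (sym (sum-+ (λ j → f zero j) (λ j → sumℚ (λ i → f (suc i) j))))

sum-split : ∀ {m} n (f : Fin (m ℕ.+ n) → ℚ) →
  sumℚ f ≡ sumℚ (λ i → f (i ↑ˡ n)) + sumℚ (λ i → f (m ↑ʳ i))
sum-split {zero} n f = sym (ℚP.+-identityˡ (sumℚ f))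
sum-split {suc m} n f = trans (cong (_+_ (f zero)) (sum-split n (λ i → f (suc i)))) (sym (ℚP.+-assoc (f zero) _ _))

sum-1 : ∀ n → sumℚ {n} (λ _ → 1ℚ) ≡ ℕtoℚ n
sum-1 zero = refl
sum-1 (suc n) = trans (cong (_+_ 1ℚ) (sum-1 n)) (sym (ℕtoℚ-suc n))

toℚ-sum : ∀ {n} (f : Fin n → ℤ) → toℚ (sumℤ f) ≡ sumℚ (λ i → toℚ (f i))
toℚ-sum {zero} f = refl
toℚ-sum {suc n} f = trans (toℚ-+ (f zero) _) (cong (_+_ (toℚ (f zero))) (toℚ-sum (λ i → f (suc i))))

sum-nonneg : ∀ {n} (f : Fin n → ℚ) → (∀ i → 0ℚ ≤ f i) → 0ℚ ≤ sumℚ f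
sum-nonneg {zero} f h = ℚP.≤-refl
sum-nonneg {suc n} f h = 0≤+ (h zero) (sum-nonneg (λ i → f (suc i)) (λ i → h (suc i)))

sum-mono : ∀ {n} (f g : Fin n → ℚ) → (∀ i → f i ≤ g i) → sumℚ f ≤ sumℚ g
sum-mono {zero} f g h = ℚP.≤-refl
sum-mono {suc n} f g h = ℚP.+-mono-≤ (h zero) (sum-mono (λ i → f (suc i)) (λ i → g (suc i)) (λ i → h (suc i)))

term≤sum : ∀ {n} (f : Fin n → ℚ) → (∀ i → 0ℚ ≤ f i) → ∀ j → f j ≤ sumℚ f
term≤sum {suc n} f h zero =
  ≤-via (solve 2 (λ a s → s := a :+ s :- a) refl (f zero) (sumℚ (λ i → f (suc i))))
        (sum-nonneg (λ i → f (suc i)) (λ i → h (suc i)))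
term≤sum {suc n} f h (suc j) =
  ≤-via (solve 3 (λ a s t → a :+ (s :- t) := a :+ s :- t) refl (f zero) (sumℚ (λ i → f (suc i))) (f (suc j)))
        (0≤+ (h zero) (≤⇒0≤- (term≤sum (λ i → f (suc i)) (λ i → h (suc i)) j)))

δ : ∀ {n} → Fin n → Fin n → ℚ
δ i j = if ⌊ i ≟ j ⌋ then 1ℚ else 0ℚ

if-yes : ∀ {P : Set} {A : Set} (d : Dec P) {a b : A} → P → (if ⌊ d ⌋ then a else b) ≡ a
if-yes (yes _) _ = refl
if-yes (no ¬p) p = ⊥-elim (¬p p)

if-no : ∀ {P : Set} {A : Set} (d : Dec P) {a b : A} → ¬ P → (if ⌊ d ⌋ then a else b) ≡ b
if-no (yes p) ¬p = ⊥-elim (¬p p)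
if-no (no _) _ = refl

δ-refl : ∀ {n} (i : Fin n) → δ i i ≡ 1ℚ
δ-refl i = if-yes (i ≟ i) refl

δ-no : ∀ {n} {i j : Fin n} → i ≢ j → δ i j ≡ 0ℚ
δ-no {i = i} {j} ne = if-no (i ≟ j) ne

δ-01 : ∀ {n} (i j : Fin n) → (δ i j ≡ 1ℚ) ⊎ (δ i j ≡ 0ℚ)
δ-01 i j with i ≟ j
... | yes _ = inj₁ refl
... | no _ = inj₂ refl

δ-sym : ∀ {n} (i j : Fin n) → δ i j ≡ δ j i
δ-sym i j with i ≟ j
... | yes refl = sym (δ-refl i)
... | no ne = sym (δ-no (λ e → ne (sym e)))

δ-inj : ∀ {m n} (f : Fin m → Fin n) → (∀ {i k} → f i ≡ f k → i ≡ k) → ∀ i k → δ (f i) (f k) ≡ δ i k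
δ-inj f f-inj i k with i ≟ k
... | yes refl = δ-refl (f i)
... | no ne = δ-no (λ e → ne (f-inj e))

δ-nonneg : ∀ {n} (i j : Fin n) → 0ℚ ≤ δ i j
δ-nonneg i j with δ-01 i j
... | inj₁ e = subst (0ℚ ≤_) (sym e) 0≤1
... | inj₂ e = ℚP.≤-reflexive (sym e)

δ≤1 : ∀ {n} (i j : Fin n) → δ i j ≤ 1ℚ
δ≤1 i j with δ-01 i j
... | inj₁ e = ℚP.≤-reflexive e
... | inj₂ e = subst (_≤ 1ℚ) (sym e) 0≤1

int-δ : ∀ {n} (i j : Fin n) → IsInt (δ i j)
int-δ i j with δ-01 i j
... | inj₁ e = + 1 , e
... | inj₂ e = + 0 , e

sum-δ : ∀ {n} (j : Fin n) (f : Fin n → ℚ) → sumℚ (λ i → δ i j * f i) ≡ f j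
sum-δ {suc n} zero f =
  trans (cong₂ _+_ (ℚP.*-identityˡ (f zero)) (trans (sum-cong (λ i → ℚP.*-zeroˡ (f (suc i)))) (sum-0 {n})))
        (ℚP.+-identityʳ (f zero))
sum-δ {suc n} (suc j) f =
  trans (cong₂ _+_ (ℚP.*-zeroˡ (f zero))
                   (trans (sum-cong (λ i → cong (_* f (suc i)) (δ-inj suc FinP.suc-injective i j)))
                          (sum-δ j (λ i → f (suc i)))))
        (ℚP.+-identityˡ _)

sum-δ' : ∀ {n} (j : Fin n) (f : Fin n → ℚ) → sumℚ (λ i → δ j i * f i) ≡ f j
sum-δ' j f = trans (sum-cong (λ i → cong (_* f i) (δ-sym j i))) (sum-δ j f)

sum-δ-1 : ∀ {n} (j : Fin n) → sumℚ (λ i → δ i j) ≡ 1ℚ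
sum-δ-1 j = trans (sum-cong (λ i → sym (ℚP.*-identityʳ (δ i j)))) (sum-δ j (λ _ → 1ℚ))

sum-1-Kδ : ∀ {n} (K : ℚ) (a : Fin n → ℚ) j → sumℚ (λ i → a i * (1ℚ - K * δ i j)) ≡ sumℚ a - K * a j
sum-1-Kδ K a j = begin
  sumℚ (λ i → a i * (1ℚ - K * δ i j))
    ≡⟨ sum-cong (λ i → solve 3 (λ a k e → a :* (con 1ℚ :- k :* e) := a :- k :* (e :* a)) refl (a i) K (δ i j)) ⟩
  sumℚ (λ i → a i - K * (δ i j * a i))
    ≡⟨ sum-- a (λ i → K * (δ i j * a i)) ⟩
  sumℚ a - sumℚ (λ i → K * (δ i j * a i))
    ≡⟨ cong (_-_ (sumℚ a)) (trans (sum-*l K (λ i → δ i j * a i)) (cong (K *_) (sum-δ j a))) ⟩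
  sumℚ a - K * a j ∎

facetVector : ∀ {d} → Fin (suc d) → Fin (suc d) → ℚ
facetVector {d} j i = 1ℚ - ℕtoℚ (suc d) * δ i j

facetVector-sum : ∀ {d} (j : Fin (suc d)) → sumℚ (facetVector j) ≡ 0ℚ
facetVector-sum {d} j = begin
  sumℚ (λ i → 1ℚ - ℕtoℚ (suc d) * δ i j)
    ≡⟨ sum-- {suc d} (λ _ → 1ℚ) (λ i → ℕtoℚ (suc d) * δ i j) ⟩
  sumℚ {suc d} (λ _ → 1ℚ) - sumℚ (λ i → ℕtoℚ (suc d) * δ i j)
    ≡⟨ cong₂ _-_ (sum-1 (suc d)) (trans (sum-*l (ℕtoℚ (suc d)) (λ i → δ i j)) (cong (ℕtoℚ (suc d) *_) (sum-δ-1 j))) ⟩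
  ℕtoℚ (suc d) - ℕtoℚ (suc d) * 1ℚ
    ≡⟨ solve 1 (λ k → k :- k :* con 1ℚ := con 0ℚ) refl (ℕtoℚ (suc d)) ⟩
  0ℚ ∎

dot-comm : ∀ {n} (x y : Point n) → dot x y ≡ dot y x
dot-comm x y = sum-cong (λ c → ℚP.*-comm (x c) (y c))

dot-congʳ : ∀ {n} (x : Point n) {y z : Point n} → (∀ c → y c ≡ z c) → dot x y ≡ dot x z
dot-congʳ x h = sum-cong (λ c → cong (x c *_) (h c))

dot-lin : ∀ {n k} (z : Point n) (λs : Fin k → ℚ) (X : Fin k → Point n) →
  dot z (λ c → sumℚ (λ i → λs i * X i c)) ≡ sumℚ (λ i → λs i * dot z (X i))
dot-lin z λs X = begin
  sumℚ (λ c → z c * sumℚ (λ i → λs i * X i c))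
    ≡⟨ sum-cong (λ c → sym (sum-*l (z c) (λ i → λs i * X i c))) ⟩
  sumℚ (λ c → sumℚ (λ i → z c * (λs i * X i c)))
    ≡⟨ sum-swap (λ c i → z c * (λs i * X i c)) ⟩
  sumℚ (λ i → sumℚ (λ c → z c * (λs i * X i c)))
    ≡⟨ sum-cong (λ i → trans (sum-cong (λ c → solve 3 (λ a b x → a :* (b :* x) := b :* (a :* x)) refl (z c) (λs i) (X i c)))
                             (sum-*l (λs i) (λ c → z c * X i c))) ⟩
  sumℚ (λ i → λs i * dot z (X i)) ∎

dot-sum : ∀ {n k} (z : Point n) (X : Fin k → Point n) →
  dot z (λ c → sumℚ (λ i → X i c)) ≡ sumℚ (λ i → dot z (X i))
dot-sum z X = trans (sum-cong (λ c → sym (sum-*l (z c) (λ i → X i c)))) (sum-swap (λ c i → z c * X i c))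

dot-zeroʳ : ∀ {n} (z y : Point n) → (∀ c → y c ≡ 0ℚ) → dot z y ≡ 0ℚ
dot-zeroʳ {n} z y h = trans (sum-cong (λ c → trans (cong (z c *_) (h c)) (ℚP.*-zeroʳ (z c)))) (sum-0 {n})

dot-scal : ∀ {n} (t : ℚ) (w x : Point n) → dot (λ c → t * w c) x ≡ t * dot w x
dot-scal t w x = trans (sum-cong (λ c → ℚP.*-assoc t (w c) (x c))) (sum-*l t (λ c → w c * x c))

dot-sub-scal : ∀ {n} (f x y : Point n) (k : ℚ) → dot (λ c → f c - k * x c) y ≡ dot f y - k * dot x y
dot-sub-scal f x y k = begin
  sumℚ (λ c → (f c - k * x c) * y c)
    ≡⟨ sum-cong (λ c → solve 4 (λ f k x y → (f :- k :* x) :* y := f :* y :- k :* (x :* y)) refl (f c) k (x c) (y c)) ⟩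
  sumℚ (λ c → f c * y c - k * (x c * y c))  ≡⟨ sum-- (λ c → f c * y c) (λ c → k * (x c * y c)) ⟩
  dot f y - sumℚ (λ c → k * (x c * y c))    ≡⟨ cong (_-_ (dot f y)) (sum-*l k (λ c → x c * y c)) ⟩
  dot f y - k * dot x y                    ∎

generator-InConv : ∀ {k d} (V : Fin k → Fin d → ℤ) j → InConv V (embed (V j))
generator-InConv V j = (λ i → δ i j) , (λ i → δ-nonneg i j) , sum-δ-1 j , (λ c → sym (sum-δ j (λ i → embed (V i) c)))

δ-transport : ∀ {n} (i k : Fin n) (f : Fin n → ℚ) → δ i k * f i ≡ δ i k * f k
δ-transport i k f with i ≟ k
... | yes refl = refl
... | no _ = trans (ℚP.*-zeroˡ (f i)) (sym (ℚP.*-zeroˡ (f k)))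

module _ {m : ℕ} (H : Graph m) where

  adjq : Fin m → Fin m → ℚ
  adjq i k = bq (adj H i k)

  degq : Fin m → ℚ
  degq i = sumℚ (adjq i)

  Lq : Fin m → Fin m → ℚ
  Lq i k = δ i k * degq i - adjq i k

  Lu : (Fin m → ℚ) → Fin m → ℚ
  Lu u i = sumℚ (λ k → Lq i k * u k)

  L-toℚ : ∀ i k → toℚ (laplacian H i k) ≡ Lq i k
  L-toℚ i k with i ≟ k
  ... | yes refl = begin
    toℚ (degree H i)                 ≡⟨ trans (toℚ-sum (λ j → if adj H i j then + 1 else + 0)) (sum-cong (λ k → toℚ-bool (adj H i k))) ⟩
    degq i                           ≡⟨ solve 1 (λ x → x := con 1ℚ :* x :- con 0ℚ) refl (degq i) ⟩
    1ℚ * degq i - 0ℚ                 ≡⟨ cong (λ b → 1ℚ * degq i - b) (sym (cong bq (irrefl H i))) ⟩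
    1ℚ * degq i - adjq i i           ∎
  ... | no ne = off-diagonal (adj H i k)
    where
    off-diagonal : ∀ b → toℚ (if b then ℤ.- (+ 1) else + 0) ≡ 0ℚ * degq i - bq b
    off-diagonal true = solve 1 (λ x → con (- 1ℚ) := con 0ℚ :* x :- con 1ℚ) refl (degq i)
    off-diagonal false = solve 1 (λ x → con 0ℚ := con 0ℚ :* x :- con 0ℚ) refl (degq i)

  Lq-sym : ∀ i k → Lq i k ≡ Lq k i
  Lq-sym i k = cong₂ _-_ (trans (δ-transport i k degq) (cong (_* degq k) (δ-sym i k))) (cong bq (Graph.sym H i k))

  Lu-formula : ∀ u i → Lu u i ≡ sumℚ (λ k → adjq i k * (u i - u k))
  Lu-formula u i = begin
    sumℚ (λ k → (δ i k * degq i - adjq i k) * u k)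
      ≡⟨ sum-cong (λ k → solve 4 (λ a b c d → (a :* b :- c) :* d := a :* d :* b :- c :* d) refl (δ i k) (degq i) (adjq i k) (u k)) ⟩
    sumℚ (λ k → δ i k * u k * degq i - adjq i k * u k)
      ≡⟨ sum-- (λ k → δ i k * u k * degq i) (λ k → adjq i k * u k) ⟩
    sumℚ (λ k → δ i k * u k * degq i) - sumℚ (λ k → adjq i k * u k)
      ≡⟨ cong (_- sumℚ (λ k → adjq i k * u k)) (trans (sum-*r (degq i) (λ k → δ i k * u k)) (cong (_* degq i) (sum-δ' i u))) ⟩
    u i * degq i - sumℚ (λ k → adjq i k * u k)
      ≡⟨ cong (_- sumℚ (λ k → adjq i k * u k)) (trans (ℚP.*-comm (u i) _) (sym (sum-*r (u i) (adjq i)))) ⟩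
    sumℚ (λ k → adjq i k * u i) - sumℚ (λ k → adjq i k * u k)
      ≡⟨ sym (sum-- (λ k → adjq i k * u i) (λ k → adjq i k * u k)) ⟩
    sumℚ (λ k → adjq i k * u i - adjq i k * u k)
      ≡⟨ sum-cong (λ k → solve 3 (λ a b c → a :* b :- a :* c := a :* (b :- c)) refl (adjq i k) (u i) (u k)) ⟩
    sumℚ (λ k → adjq i k * (u i - u k)) ∎

  rowsum : ∀ i → sumℚ (Lq i) ≡ 0ℚ
  rowsum i = begin
    sumℚ (Lq i)                               ≡⟨ sum-cong (λ k → sym (ℚP.*-identityʳ (Lq i k))) ⟩
    Lu (λ _ → 1ℚ) i                           ≡⟨ Lu-formula (λ _ → 1ℚ) i ⟩
    sumℚ (λ k → adjq i k * (1ℚ - 1ℚ))         ≡⟨ sum-cong (λ k → ℚP.*-zeroʳ (adjq i k)) ⟩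
    sumℚ (λ (k : Fin m) → 0ℚ)                 ≡⟨ sum-0 {m} ⟩
    0ℚ                                        ∎

  colsum : ∀ k → sumℚ (λ i → Lq i k) ≡ 0ℚ
  colsum k = trans (sum-cong (λ i → Lq-sym i k)) (rowsum k)

  Lu-shift : ∀ u a i → Lu (λ k → u k - a) i ≡ Lu u i
  Lu-shift u a i = begin
    sumℚ (λ k → Lq i k * (u k - a))
      ≡⟨ sum-cong (λ k → solve 3 (λ x y z → x :* (y :- z) := x :* y :- z :* x) refl (Lq i k) (u k) a) ⟩
    sumℚ (λ k → Lq i k * u k - a * Lq i k)
      ≡⟨ sum-- (λ k → Lq i k * u k) (λ k → a * Lq i k) ⟩
    Lu u i - sumℚ (λ k → a * Lq i k)
      ≡⟨ cong (_-_ (Lu u i)) (trans (sum-*l a (Lq i)) (trans (cong (a *_) (rowsum i)) (ℚP.*-zeroʳ a))) ⟩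
    Lu u i - 0ℚ
      ≡⟨ solve 1 (λ x → x :- con 0ℚ := x) refl (Lu u i) ⟩
    Lu u i ∎

  Lu-scale : ∀ s u i → Lu (λ k → s * u k) i ≡ s * Lu u i
  Lu-scale s u i = trans (sum-cong (λ k → solve 3 (λ l s u → l :* (s :* u) := s :* (l :* u)) refl (Lq i k) s (u k)))
                         (sum-*l s (λ k → Lq i k * u k))

  Lu-sum : ∀ u → sumℚ (Lu u) ≡ 0ℚ
  Lu-sum u = begin
    sumℚ (λ i → sumℚ (λ k → Lq i k * u k))
      ≡⟨ sum-swap (λ i k → Lq i k * u k) ⟩
    sumℚ (λ k → sumℚ (λ i → Lq i k * u k))
      ≡⟨ sum-cong (λ k → trans (sum-*r (u k) (λ i → Lq i k)) (trans (cong (_* u k) (colsum k)) (ℚP.*-zeroˡ (u k)))) ⟩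
    sumℚ (λ (k : Fin m) → 0ℚ)
      ≡⟨ sum-0 {m} ⟩
    0ℚ ∎

Aq : ∀ {d} → Fin (suc d) → Fin d → ℚ
Aq k c = bq (toℕ k ≤ᵇ toℕ c)

Aq-suc : ∀ {d} (k : Fin (suc d)) (c : Fin d) → Aq (suc k) (suc c) ≡ Aq k c
Aq-suc k c = cong bq (suc-≤ᵇ (toℕ k) (toℕ c))
  where
  suc-≤ᵇ : ∀ a b → (suc a ≤ᵇ suc b) ≡ (a ≤ᵇ b)
  suc-≤ᵇ zero b = refl
  suc-≤ᵇ (suc a) b = refl

Du : ∀ {d} → (Fin (suc d) → ℚ) → Fin d → ℚ
Du u c = u (inject₁ c) - u (suc c)

telescope : ∀ d (u : Fin (suc d) → ℚ) (k : Fin (suc d)) →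
  sumℚ (λ c → Aq k c * Du u c) ≡ u k - u (fromℕ d)
telescope zero u zero = sym (ℚP.+-inverseʳ (u zero))
telescope (suc d) u zero = begin
  1ℚ * (u zero - u (suc zero)) + sumℚ (λ c → Aq zero (suc c) * Du u (suc c))
    ≡⟨ cong (_+_ (1ℚ * (u zero - u (suc zero)))) (telescope d (λ i → u (suc i)) zero) ⟩
  1ℚ * (u zero - u (suc zero)) + (u (suc zero) - u (suc (fromℕ d)))
    ≡⟨ solve 3 (λ a b c → con 1ℚ :* (a :- b) :+ (b :- c) := a :- c) refl (u zero) (u (suc zero)) (u (suc (fromℕ d))) ⟩
  u zero - u (fromℕ (suc d)) ∎
telescope (suc d) u (suc k) = begin
  0ℚ * (u zero - u (suc zero)) + sumℚ (λ c → Aq (suc k) (suc c) * Du u (suc c))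
    ≡⟨ cong₂ _+_ (ℚP.*-zeroˡ (u zero - u (suc zero))) (sum-cong (λ c → cong (_* Du u (suc c)) (Aq-suc k c))) ⟩
  0ℚ + sumℚ (λ c → Aq k c * Du (λ i → u (suc i)) c)
    ≡⟨ ℚP.+-identityˡ _ ⟩
  sumℚ (λ c → Aq k c * Du (λ i → u (suc i)) c)
    ≡⟨ telescope d (λ i → u (suc i)) k ⟩
  u (suc k) - u (fromℕ (suc d)) ∎

Aᵀ-injective : ∀ d (y : Fin (suc d) → ℚ) → (∀ c → sumℚ (λ k → y k * Aq k c) ≡ 0ℚ) →
  sumℚ y ≡ 0ℚ → ∀ k → y k ≡ 0ℚ
Aᵀ-injective zero y hA hs zero = trans (sym (ℚP.+-identityʳ (y zero))) hs
Aᵀ-injective (suc d) y hA hs = go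
  where
  cancelˡ : ∀ {a b} → a + b ≡ 0ℚ → a ≡ 0ℚ → b ≡ 0ℚ
  cancelˡ {a} {b} e ea = trans (sym (ℚP.+-identityˡ b)) (trans (cong (_+ b) (sym ea)) e)
  y0 : y zero ≡ 0ℚ
  y0 = trans (sym (trans (cong₂ _+_ (ℚP.*-identityʳ (y zero))
                 (trans (sum-cong (λ k → ℚP.*-zeroʳ (y (suc k)))) (sum-0 {suc d}))) (ℚP.+-identityʳ (y zero))))
             (hA zero)
  tailA : ∀ c → sumℚ (λ k → y (suc k) * Aq k c) ≡ 0ℚ
  tailA c = cancelˡ (trans (cong (_+_ (y zero * 1ℚ)) (sym (sum-cong (λ k → cong (y (suc k) *_) (Aq-suc k c))))) (hA (suc c)))
                    (trans (ℚP.*-identityʳ (y zero)) y0)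
  go : ∀ k → y k ≡ 0ℚ
  go zero = y0
  go (suc k) = Aᵀ-injective d (λ i → y (suc i)) tailA (cancelˡ hs y0) k

bq-true : ∀ {x} → T x → bq x ≡ 1ℚ
bq-true {true} _ = refl

bq-false : ∀ {x} → ¬ T x → bq x ≡ 0ℚ
bq-false {true} n = ⊥-elim (n tt)
bq-false {false} _ = refl

Aq-inject₁ : ∀ {d} (c c' : Fin d) → Aq (inject₁ c) c' ≡ bq (toℕ c ≤ᵇ toℕ c')
Aq-inject₁ c c' = cong (λ z → bq (z ≤ᵇ toℕ c')) (FinP.toℕ-inject₁ c)

A-difference : ∀ {d} (c c' : Fin d) → Aq (inject₁ c) c' - Aq (suc c) c' ≡ δ c c'
A-difference c c' with ℕP.<-cmp (toℕ c) (toℕ c')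
... | tri< lt _ _ =
  trans (cong₂ _-_ (trans (Aq-inject₁ c c') (bq-true (ℕP.≤⇒≤ᵇ (ℕP.<⇒≤ lt)))) (bq-true (ℕP.≤⇒≤ᵇ lt)))
        (sym (δ-no (λ e → ℕP.<⇒≢ lt (cong toℕ e))))
... | tri≈ _ eq _ =
  trans (cong₂ _-_ (trans (Aq-inject₁ c c') (bq-true (ℕP.≤⇒≤ᵇ (ℕP.≤-reflexive eq))))
                   (bq-false (λ t → ℕP.<-irrefl eq (ℕP.≤ᵇ⇒≤ (suc (toℕ c)) (toℕ c') t))))
        (sym (trans (cong (δ c) (sym (FinP.toℕ-injective eq))) (δ-refl c)))
... | tri> _ _ gt =
  trans (cong₂ _-_ (trans (Aq-inject₁ c c') (bq-false (λ t → ℕP.<⇒≱ gt (ℕP.≤ᵇ⇒≤ (toℕ c) (toℕ c') t))))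
                   (bq-false (λ t → ℕP.<⇒≱ gt (ℕP.<⇒≤ (ℕP.≤ᵇ⇒≤ (suc (toℕ c)) (toℕ c') t)))))
        (sym (δ-no (λ e → ℕP.>⇒≢ gt (cong toℕ e))))

Spans : ∀ {k d} → (Fin k → Point d) → Set
Spans {k} {d} P = Σ (Fin d → Fin k → ℚ) λ M → ∀ c c' → sumℚ (λ i → M c i * P i c') ≡ δ c c'

Spans-cong : ∀ {k d} {P Q : Fin k → Point d} → (∀ i c → P i c ≡ Q i c) → Spans P → Spans Q
Spans-cong P≡Q (M , hM) = M , λ c c' → trans (sum-cong (λ i → cong (M c i *_) (sym (P≡Q i c')))) (hM c c')

Spans-orthogonal : ∀ {k d} (P : Fin k → Point d) → Spans P →
  ∀ (z : Point d) → (∀ i → dot z (P i) ≡ 0ℚ) → ∀ c → z c ≡ 0ℚ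
Spans-orthogonal {k} P (M , hM) z h c = begin
  z c                                              ≡⟨ sym (sum-δ' c z) ⟩
  sumℚ (λ c' → δ c c' * z c')                      ≡⟨ sum-cong (λ c' → cong (_* z c') (sym (hM c c'))) ⟩
  sumℚ (λ c' → sumℚ (λ i → M c i * P i c') * z c')
    ≡⟨ sum-cong (λ c' → trans (sym (sum-*r (z c') (λ i → M c i * P i c')))
                              (sum-cong (λ i → solve 3 (λ m v z → m :* v :* z := m :* (z :* v)) refl (M c i) (P i c') (z c')))) ⟩
  sumℚ (λ c' → sumℚ (λ i → M c i * (z c' * P i c')))
    ≡⟨ sum-swap (λ c' i → M c i * (z c' * P i c')) ⟩
  sumℚ (λ i → sumℚ (λ c' → M c i * (z c' * P i c')))
    ≡⟨ sum-cong (λ i → trans (sum-*l (M c i) (λ c' → z c' * P i c')) (trans (cong (M c i *_) (h i)) (ℚP.*-zeroʳ (M c i)))) ⟩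
  sumℚ (λ (i : Fin k) → 0ℚ)                        ≡⟨ sum-0 {k} ⟩
  0ℚ                                               ∎

Spans-expand : ∀ {k d} (P : Fin k → Point d) → ((M , _) : Spans P) →
  ∀ (z : Point d) c' → sumℚ (λ i → sumℚ (λ c → z c * M c i) * P i c') ≡ z c'
Spans-expand P (M , hM) z c' = begin
  sumℚ (λ i → sumℚ (λ c → z c * M c i) * P i c')
    ≡⟨ sum-cong (λ i → trans (sym (sum-*r (P i c') (λ c → z c * M c i)))
                             (sum-cong (λ c → ℚP.*-assoc (z c) (M c i) (P i c')))) ⟩
  sumℚ (λ i → sumℚ (λ c → z c * (M c i * P i c')))
    ≡⟨ sum-swap (λ i c → z c * (M c i * P i c')) ⟩
  sumℚ (λ c → sumℚ (λ i → z c * (M c i * P i c')))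
    ≡⟨ sum-cong (λ c → trans (sum-*l (z c) (λ i → M c i * P i c')) (cong (z c *_) (hM c c'))) ⟩
  sumℚ (λ c → z c * δ c c')
    ≡⟨ sum-cong (λ c → trans (ℚP.*-comm (z c) (δ c c')) (cong (_* z c) (δ-sym c c'))) ⟩
  sumℚ (λ c → δ c' c * z c)
    ≡⟨ sum-δ' c' z ⟩
  z c' ∎

-- A polytope with the origin in its interior is full-dimensional: each
-- ε e_c lies in conv V, and dividing its coefficients by ε expresses e_c.
interior⇒spans : ∀ {k d} (V : Fin k → Fin d → ℤ) → OriginInInterior V → Spans (λ i → embed (V i))
interior⇒spans {k} {d} V (ε , ε>0 , box) = M , hM
  where
  instance
    ε≢0 : ℚ.NonZero ε
    ε≢0 = ℚP.pos⇒nonZero ε {{ℚ.positive ε>0}}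
  εe-in-box : ∀ c c' → (- ε) ≤ ε * δ c c' × ε * δ c c' ≤ ε
  εe-in-box c c' =
      ≤-via (solve 2 (λ e x → e :* (x :+ con 1ℚ) := e :* x :- (:- e)) refl ε (δ c c'))
            (0≤* (ℚP.<⇒≤ ε>0) (0≤+ (δ-nonneg c c') 0≤1))
    , ≤-via (solve 2 (λ e x → e :* (con 1ℚ :- x) := e :- e :* x) refl ε (δ c c'))
            (0≤* (ℚP.<⇒≤ ε>0) (≤⇒0≤- (δ≤1 c c')))
  εe : ∀ c → InConv V (λ c' → ε * δ c c')
  εe c = box (λ c' → ε * δ c c') (εe-in-box c)
  M : Fin d → Fin k → ℚ
  M c i = proj₁ (εe c) i * ℚ.1/ ε
  hM : ∀ c c' → sumℚ (λ i → M c i * embed (V i) c') ≡ δ c c'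
  hM c c' = begin
    sumℚ (λ i → λs i * ℚ.1/ ε * embed (V i) c')
      ≡⟨ sum-cong (λ i → solve 3 (λ a b v → a :* b :* v := b :* (a :* v)) refl (λs i) (ℚ.1/ ε) (embed (V i) c')) ⟩
    sumℚ (λ i → ℚ.1/ ε * (λs i * embed (V i) c'))
      ≡⟨ sum-*l (ℚ.1/ ε) (λ i → λs i * embed (V i) c') ⟩
    ℚ.1/ ε * sumℚ (λ i → λs i * embed (V i) c')
      ≡⟨ cong (ℚ.1/ ε *_) (sym (proj₂ (proj₂ (proj₂ (εe c))) c')) ⟩
    ℚ.1/ ε * (ε * δ c c')
      ≡⟨ sym (ℚP.*-assoc (ℚ.1/ ε) ε (δ c c')) ⟩
    ℚ.1/ ε * ε * δ c c'
      ≡⟨ trans (cong (_* δ c c') (ℚP.*-inverseˡ ε)) (ℚP.*-identityˡ (δ c c')) ⟩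
    δ c c' ∎
    where
    λs = proj₁ (εe c)

-- The vertices of T_H and the Laplacian equation

module _ {d : ℕ} (H : Graph (suc d)) where

  Vq : Fin (suc d) → Point d
  Vq i c = sumℚ (λ k → Lq H i k * Aq k c)

  Vq-embed : ∀ i c → embed (laplacianSimplex H i) c ≡ Vq i c
  Vq-embed i c = trans (toℚ-sum (λ k → laplacian H i k ℤ.* matA k c))
    (sum-cong (λ k → trans (toℚ-* (laplacian H i k) (matA k c))
                           (cong₂ _*_ (L-toℚ H i k) (toℚ-bool (toℕ k ≤ᵇ toℕ c)))))

  Vq-sum : ∀ c → sumℚ (λ i → Vq i c) ≡ 0ℚ
  Vq-sum c = begin
    sumℚ (λ i → sumℚ (λ k → Lq H i k * Aq k c))
      ≡⟨ sum-swap (λ i k → Lq H i k * Aq k c) ⟩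
    sumℚ (λ k → sumℚ (λ i → Lq H i k * Aq k c))
      ≡⟨ sum-cong (λ k → trans (sum-*r (Aq k c) (λ i → Lq H i k)) (trans (cong (_* Aq k c) (colsum H k)) (ℚP.*-zeroˡ (Aq k c)))) ⟩
    sumℚ (λ (k : Fin (suc d)) → 0ℚ)
      ≡⟨ sum-0 {suc d} ⟩
    0ℚ ∎

  -- Symmetry of L: (Aᵀ L u)_c = Σ_l u_l V_lc.
  Aᵀ-Lu : ∀ u c → sumℚ (λ k → Lu H u k * Aq k c) ≡ sumℚ (λ l → u l * Vq l c)
  Aᵀ-Lu u c = begin
    sumℚ (λ k → sumℚ (λ l → Lq H k l * u l) * Aq k c)
      ≡⟨ sum-cong (λ k → sym (sum-*r (Aq k c) (λ l → Lq H k l * u l))) ⟩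
    sumℚ (λ k → sumℚ (λ l → Lq H k l * u l * Aq k c))
      ≡⟨ sum-swap (λ k l → Lq H k l * u l * Aq k c) ⟩
    sumℚ (λ l → sumℚ (λ k → Lq H k l * u l * Aq k c))
      ≡⟨ sum-cong (λ l → trans (sum-cong (λ k → trans (cong (λ z → z * u l * Aq k c) (Lq-sym H k l))
                                                        (solve 3 (λ x y z → x :* y :* z := y :* (x :* z)) refl (Lq H l k) (u l) (Aq k c))))
                               (sum-*l (u l) (λ k → Lq H l k * Aq k c))) ⟩
    sumℚ (λ l → u l * Vq l c) ∎

  Du-dot : ∀ u i → dot (Du u) (Vq i) ≡ Lu H u i
  Du-dot u i = begin
    sumℚ (λ c → Du u c * sumℚ (λ k → Lq H i k * Aq k c))
      ≡⟨ sum-cong (λ c → sym (sum-*l (Du u c) (λ k → Lq H i k * Aq k c))) ⟩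
    sumℚ (λ c → sumℚ (λ k → Du u c * (Lq H i k * Aq k c)))
      ≡⟨ sum-swap (λ c k → Du u c * (Lq H i k * Aq k c)) ⟩
    sumℚ (λ k → sumℚ (λ c → Du u c * (Lq H i k * Aq k c)))
      ≡⟨ sum-cong (λ k → trans (sum-cong (λ c → solve 3 (λ x y z → x :* (y :* z) := y :* (z :* x)) refl (Du u c) (Lq H i k) (Aq k c)))
                               (trans (sum-*l (Lq H i k) (λ c → Aq k c * Du u c)) (cong (Lq H i k *_) (telescope d u k)))) ⟩
    sumℚ (λ k → Lq H i k * (u k - u (fromℕ d)))
      ≡⟨ Lu-shift H u (u (fromℕ d)) i ⟩
    Lu H u i ∎

  Solvable : Set
  Solvable = ∀ t → sumℚ t ≡ 0ℚ → Σ (Fin (suc d) → ℚ) λ u → ∀ k → Lu H u k ≡ t k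

  -- If the V_i span, u = Σ_c (Aᵀ t)_c M_c solves L u = t: Aᵀ (L u - t) = 0
  -- and L u - t has sum 0, so L u = t.
  spans⇒solvable : Spans Vq → Solvable
  spans⇒solvable S@(M , _) t t-sum = u , λ k → a-b≡0⇒a≡b (Aᵀ-injective d y Aᵀy y-sum k)
    where
    Aᵀt : Fin d → ℚ
    Aᵀt c = sumℚ (λ k → t k * Aq k c)
    u : Fin (suc d) → ℚ
    u l = sumℚ (λ c → Aᵀt c * M c l)
    y : Fin (suc d) → ℚ
    y k = Lu H u k - t k
    Aᵀy : ∀ c → sumℚ (λ k → y k * Aq k c) ≡ 0ℚ
    Aᵀy c = begin
      sumℚ (λ k → (Lu H u k - t k) * Aq k c)
        ≡⟨ sum-cong (λ k → solve 3 (λ a b x → (a :- b) :* x := a :* x :- b :* x) refl (Lu H u k) (t k) (Aq k c)) ⟩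
      sumℚ (λ k → Lu H u k * Aq k c - t k * Aq k c)
        ≡⟨ sum-- (λ k → Lu H u k * Aq k c) (λ k → t k * Aq k c) ⟩
      sumℚ (λ k → Lu H u k * Aq k c) - Aᵀt c
        ≡⟨ cong (_- Aᵀt c) (trans (Aᵀ-Lu u c) (Spans-expand Vq S Aᵀt c)) ⟩
      Aᵀt c - Aᵀt c
        ≡⟨ ℚP.+-inverseʳ (Aᵀt c) ⟩
      0ℚ ∎
    y-sum : sumℚ y ≡ 0ℚ
    y-sum = trans (sum-- (Lu H u) t) (cong₂ _-_ (Lu-sum H u) t-sum)

  -- Conversely, if L μ = e_c - e_{c+1} then Σ_i μ_i V_i = Aᵀ (e_c - e_{c+1}) = e_c.
  solvable⇒spans : Solvable → Spans Vq
  solvable⇒spans solve-L = M , span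
    where
    t : Fin d → Fin (suc d) → ℚ
    t c v = δ v (inject₁ c) - δ v (suc c)
    t-sum : ∀ c → sumℚ (t c) ≡ 0ℚ
    t-sum c = trans (sum-- (λ v → δ v (inject₁ c)) (λ v → δ v (suc c)))
                    (trans (cong₂ _-_ (sum-δ-1 (inject₁ c)) (sum-δ-1 (suc c))) (ℚP.+-inverseʳ 1ℚ))
    M : Fin d → Fin (suc d) → ℚ
    M c = proj₁ (solve-L (t c) (t-sum c))
    span : ∀ c c' → sumℚ (λ i → M c i * Vq i c') ≡ δ c c'
    span c c' = begin
      sumℚ (λ i → M c i * Vq i c')
        ≡⟨ sym (Aᵀ-Lu (M c) c') ⟩
      sumℚ (λ k → Lu H (M c) k * Aq k c')
        ≡⟨ sum-cong (λ k → cong (_* Aq k c') (proj₂ (solve-L (t c) (t-sum c)) k)) ⟩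
      sumℚ (λ k → (δ k (inject₁ c) - δ k (suc c)) * Aq k c')
        ≡⟨ sum-cong (λ k → solve 3 (λ a b x → (a :- b) :* x := a :* x :- b :* x) refl (δ k (inject₁ c)) (δ k (suc c)) (Aq k c')) ⟩
      sumℚ (λ k → δ k (inject₁ c) * Aq k c' - δ k (suc c) * Aq k c')
        ≡⟨ sum-- (λ k → δ k (inject₁ c) * Aq k c') (λ k → δ k (suc c) * Aq k c') ⟩
      sumℚ (λ k → δ k (inject₁ c) * Aq k c') - sumℚ (λ k → δ k (suc c) * Aq k c')
        ≡⟨ cong₂ _-_ (sum-δ (inject₁ c) (λ k → Aq k c')) (sum-δ (suc c) (λ k → Aq k c')) ⟩
      Aq (inject₁ c) c' - Aq (suc c) c'
        ≡⟨ A-difference c c' ⟩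
      δ c c' ∎

-- A reflexivity criterion for simplices

scaled-InConv : ∀ {d'} (U : Fin (suc d') → Fin d' → ℤ) (a : Fin (suc d') → ℚ) (x : Point d') →
  (∀ j → 0ℚ ≤ a j) → sumℚ a ≡ ℕtoℚ (suc d') →
  (∀ c → sumℚ (λ j → a j * embed (U j) c) ≡ ℕtoℚ (suc d') * x c) → InConv U x
scaled-InConv {d'} U a x a≥0 a-sum a-rep =
  (λ j → a j * recip d') , (λ j → 0≤* (a≥0 j) (recip-nonneg d')) ,
  trans (sum-*r (recip d') a) (trans (cong (_* recip d') a-sum) (recip-inverse d')) ,
  λ c → sym (begin
    sumℚ (λ j → a j * recip d' * embed (U j) c)
      ≡⟨ sum-cong (λ j → solve 3 (λ a k w → a :* k :* w := k :* (a :* w)) refl (a j) (recip d') (embed (U j) c)) ⟩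
    sumℚ (λ j → recip d' * (a j * embed (U j) c))
      ≡⟨ sum-*l (recip d') (λ j → a j * embed (U j) c) ⟩
    recip d' * sumℚ (λ j → a j * embed (U j) c)
      ≡⟨ cong (recip d' *_) (a-rep c) ⟩
    recip d' * (ℕtoℚ (suc d') * x c)
      ≡⟨ solve 3 (λ r k x → r :* (k :* x) := (k :* r) :* x) refl (recip d') (ℕtoℚ (suc d')) (x c) ⟩
    (ℕtoℚ (suc d') * recip d') * x c
      ≡⟨ trans (cong (_* x c) (recip-inverse d')) (ℚP.*-identityˡ (x c)) ⟩
    x c ∎)

sum-1-dot : ∀ {d'} (Q : Fin (suc d') → Point d') → (∀ c → sumℚ (λ i → Q i c) ≡ 0ℚ) →
  ∀ (x : Point d') → sumℚ (λ j → 1ℚ - dot x (Q j)) ≡ ℕtoℚ (suc d')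
sum-1-dot {d'} Q Q-sum x = begin
  sumℚ (λ j → 1ℚ - dot x (Q j))                        ≡⟨ sum-- {suc d'} (λ _ → 1ℚ) (λ j → dot x (Q j)) ⟩
  sumℚ {suc d'} (λ _ → 1ℚ) - sumℚ (λ j → dot x (Q j))
    ≡⟨ cong₂ _-_ (sum-1 (suc d')) (trans (sym (dot-sum x Q)) (dot-zeroʳ x (λ c → sumℚ (λ i → Q i c)) Q-sum)) ⟩
  ℕtoℚ (suc d') - 0ℚ                                   ≡⟨ solve 1 (λ k → k :- con 0ℚ := k) refl (ℕtoℚ (suc d')) ⟩
  ℕtoℚ (suc d')                                        ∎

dual-expansion : ∀ {d'} (P Q : Fin (suc d') → Point d') →
  (∀ i j → dot (Q i) (P j) ≡ 1ℚ - ℕtoℚ (suc d') * δ i j) →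
  (∀ c → sumℚ (λ i → Q i c) ≡ 0ℚ) →
  (∀ (z : Point d') → (∀ i → dot z (Q i) ≡ 0ℚ) → ∀ c → z c ≡ 0ℚ) →
  ∀ (x : Point d') c → sumℚ (λ j → (1ℚ - dot x (Q j)) * P j c) ≡ ℕtoℚ (suc d') * x c
dual-expansion {d'} P Q QP Q-sum Q-orth x c = a-b≡0⇒a≡b (Q-orth z z⊥Q c)
  where
  K : ℚ
  K = ℕtoℚ (suc d')
  a : Fin (suc d') → ℚ
  a j = 1ℚ - dot x (Q j)
  lin : Point d'
  lin c = sumℚ (λ j → a j * P j c)
  z : Point d'
  z c = lin c - K * x c
  z⊥Q : ∀ i → dot z (Q i) ≡ 0ℚ
  z⊥Q i = begin
    dot z (Q i)                                    ≡⟨ dot-sub-scal lin x (Q i) K ⟩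
    dot lin (Q i) - K * dot x (Q i)
      ≡⟨ cong (_- K * dot x (Q i)) (trans (dot-comm lin (Q i)) (dot-lin (Q i) a P)) ⟩
    sumℚ (λ j → a j * dot (Q i) (P j)) - K * dot x (Q i)
      ≡⟨ cong (_- K * dot x (Q i)) (sum-cong (λ j → cong (a j *_) (trans (QP i j) (cong (λ e → 1ℚ - K * e) (δ-sym i j))))) ⟩
    sumℚ (λ j → a j * (1ℚ - K * δ j i)) - K * dot x (Q i)
      ≡⟨ cong (_- K * dot x (Q i)) (trans (sum-1-Kδ K a i) (cong (_- K * a i) (sum-1-dot Q Q-sum x))) ⟩
    K - K * (1ℚ - dot x (Q i)) - K * dot x (Q i)
      ≡⟨ solve 2 (λ k t → k :- k :* (con 1ℚ :- t) :- k :* t := con 0ℚ) refl K (dot x (Q i)) ⟩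
    0ℚ                                             ∎

module ReflexivityCriterion {d' : ℕ} (V W : Fin (suc d') → Fin d' → ℤ)
  (V-sum : ∀ c → sumℚ (λ i → embed (V i) c) ≡ 0ℚ)
  (V-spans : Spans (λ i → embed (V i)))
  (WV : ∀ j i → dot (embed (W j)) (embed (V i)) ≡ facetVector j i) where

  K : ℚ
  K = ℕtoℚ (suc d')

  Vv Ww : Fin (suc d') → Point d'
  Vv i = embed (V i)
  Ww j = embed (W j)

  VW : ∀ i j → dot (Vv i) (Ww j) ≡ 1ℚ - K * δ i j
  VW i j = trans (dot-comm (Vv i) (Ww j)) (WV j i)

  WV' : ∀ i j → dot (Ww i) (Vv j) ≡ 1ℚ - K * δ i j
  WV' i j = trans (WV i j) (cong (λ e → 1ℚ - K * e) (δ-sym j i))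

  V-orthogonal : ∀ (z : Point d') → (∀ i → dot z (Vv i) ≡ 0ℚ) → ∀ c → z c ≡ 0ℚ
  V-orthogonal = Spans-orthogonal Vv V-spans

  -- The W_j sum to 0, since (Σ_j W_j) · V_i = Σ_j (1 - n δ_ij) = 0.
  W-sum : ∀ c → sumℚ (λ j → Ww j c) ≡ 0ℚ
  W-sum = V-orthogonal (λ c → sumℚ (λ j → Ww j c)) λ i → begin
    dot (λ c → sumℚ (λ j → Ww j c)) (Vv i)  ≡⟨ dot-comm (λ c → sumℚ (λ j → Ww j c)) (Vv i) ⟩
    dot (Vv i) (λ c → sumℚ (λ j → Ww j c))  ≡⟨ dot-sum (Vv i) Ww ⟩
    sumℚ (λ j → dot (Vv i) (Ww j))          ≡⟨ sum-cong (VW i) ⟩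
    sumℚ (λ j → 1ℚ - K * δ i j)             ≡⟨ trans (sum-cong (λ j → cong (λ e → 1ℚ - K * e) (δ-sym i j))) (facetVector-sum i) ⟩
    0ℚ                                      ∎

  -- Only 0 is orthogonal to all W_j: write z = Σ_i α_i V_i; then
  -- 0 = z · W_j = Σ α - n α_j, so α is constant and z = α Σ_i V_i = 0.
  W-orthogonal : ∀ (z : Point d') → (∀ j → dot z (Ww j) ≡ 0ℚ) → ∀ c → z c ≡ 0ℚ
  W-orthogonal z z⊥W c' = begin
    z c'                                        ≡⟨ sym (Spans-expand Vv V-spans z c') ⟩
    sumℚ (λ i → α i * Vv i c')                  ≡⟨ sum-cong (λ i → cong (_* Vv i c') (α-constant i)) ⟩
    sumℚ (λ i → sα * recip d' * Vv i c')        ≡⟨ sum-*l (sα * recip d') (λ i → Vv i c') ⟩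
    sα * recip d' * sumℚ (λ i → Vv i c')        ≡⟨ cong (sα * recip d' *_) (V-sum c') ⟩
    sα * recip d' * 0ℚ                          ≡⟨ ℚP.*-zeroʳ (sα * recip d') ⟩
    0ℚ                                          ∎
    where
    α : Fin (suc d') → ℚ
    α i = sumℚ (λ c → z c * proj₁ V-spans c i)
    sα : ℚ
    sα = sumℚ α
    sα-Kα≡0 : ∀ j → sα - K * α j ≡ 0ℚ
    sα-Kα≡0 j = begin
      sα - K * α j                              ≡⟨ sym (sum-1-Kδ K α j) ⟩
      sumℚ (λ i → α i * (1ℚ - K * δ i j))       ≡⟨ sum-cong (λ i → cong (α i *_) (sym (VW i j))) ⟩
      sumℚ (λ i → α i * dot (Vv i) (Ww j))
        ≡⟨ sym (trans (dot-lin (Ww j) α Vv) (sum-cong (λ i → cong (α i *_) (dot-comm (Ww j) (Vv i))))) ⟩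
      dot (Ww j) (λ c → sumℚ (λ i → α i * Vv i c))
        ≡⟨ dot-congʳ (Ww j) (Spans-expand Vv V-spans z) ⟩
      dot (Ww j) z                              ≡⟨ trans (dot-comm (Ww j) z) (z⊥W j) ⟩
      0ℚ                                        ∎
    α-constant : ∀ i → α i ≡ sα * recip d'
    α-constant i = begin
      α i                                      ≡⟨ sym (trans (cong (α i *_) (recip-inverse d')) (ℚP.*-identityʳ (α i))) ⟩
      α i * (K * recip d')                     ≡⟨ sym (ℚP.+-identityʳ (α i * (K * recip d'))) ⟩
      α i * (K * recip d') + 0ℚ                ≡⟨ cong (_+_ (α i * (K * recip d'))) (sym (trans (cong (_* recip d') (sα-Kα≡0 i)) (ℚP.*-zeroˡ (recip d')))) ⟩
      α i * (K * recip d') + (sα - K * α i) * recip d'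
        ≡⟨ solve 4 (λ a k r s → a :* (k :* r) :+ (s :- k :* a) :* r := s :* r) refl (α i) K (recip d') sα ⟩
      sα * recip d'                            ∎

  W-expansion : ∀ (x : Point d') c → sumℚ (λ j → (1ℚ - dot x (Vv j)) * Ww j c) ≡ K * x c
  W-expansion = dual-expansion Ww Vv VW V-sum V-orthogonal

  V-expansion : ∀ (x : Point d') c → sumℚ (λ i → (1ℚ - dot x (Ww i)) * Vv i c) ≡ K * x c
  V-expansion = dual-expansion Vv Ww WV' W-sum W-orthogonal

  -- The dual of conv V is contained in conv W (coefficients (1 - x·V_j)/n).
  dual⇒conv : ∀ x → InDual V x → InConv W x
  dual⇒conv x x∈dual =
    scaled-InConv W (λ j → 1ℚ - dot x (Vv j)) x
      (λ j → ≤⇒0≤- (x∈dual (Vv j) (generator-InConv V j))) (sum-1-dot Vv V-sum x) (W-expansion x)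

  -- conv W is contained in the dual: for x = Σ κ_j W_j and y = Σ λ_i V_i,
  -- x · y = 1 - n Σ_j κ_j λ_j ≤ 1.
  conv⇒dual : ∀ x → InConv W x → InDual V x
  conv⇒dual x (κ , κ≥0 , κ-sum , x-rep) y (λs , λ≥0 , λ-sum , y-rep) =
    ≤-via x·y (0≤* (0≤ℕ (suc d')) (sum-nonneg (λ j → κ j * λs j) (λ j → 0≤* (κ≥0 j) (λ≥0 j))))
    where
    W·y : ∀ j → dot (Ww j) y ≡ 1ℚ - K * λs j
    W·y j = begin
      dot (Ww j) y                               ≡⟨ dot-congʳ (Ww j) y-rep ⟩
      dot (Ww j) (λ c → sumℚ (λ i → λs i * Vv i c))  ≡⟨ dot-lin (Ww j) λs Vv ⟩
      sumℚ (λ i → λs i * dot (Ww j) (Vv i))      ≡⟨ sum-cong (λ i → cong (λs i *_) (WV j i)) ⟩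
      sumℚ (λ i → λs i * (1ℚ - K * δ i j))       ≡⟨ sum-1-Kδ K λs j ⟩
      sumℚ λs - K * λs j                         ≡⟨ cong (_- K * λs j) λ-sum ⟩
      1ℚ - K * λs j                              ∎
    x·y : K * sumℚ (λ j → κ j * λs j) ≡ 1ℚ - dot x y
    x·y = begin
      K * sumℚ (λ j → κ j * λs j)                ≡⟨ solve 2 (λ k s → k :* s := con 1ℚ :- (con 1ℚ :- k :* s)) refl K (sumℚ (λ j → κ j * λs j)) ⟩
      1ℚ - (1ℚ - K * sumℚ (λ j → κ j * λs j))    ≡⟨ cong (λ e → 1ℚ - (e - K * sumℚ (λ j → κ j * λs j))) (sym κ-sum) ⟩
      1ℚ - (sumℚ κ - K * sumℚ (λ j → κ j * λs j))
        ≡⟨ cong (λ e → 1ℚ - (sumℚ κ - e)) (sym (sum-*l K (λ j → κ j * λs j))) ⟩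
      1ℚ - (sumℚ κ - sumℚ (λ j → K * (κ j * λs j)))
        ≡⟨ cong (_-_ 1ℚ) (sym (sum-- κ (λ j → K * (κ j * λs j)))) ⟩
      1ℚ - sumℚ (λ j → κ j - K * (κ j * λs j))
        ≡⟨ cong (_-_ 1ℚ) (sum-cong (λ j → solve 3 (λ a k l → a :- k :* (a :* l) := a :* (con 1ℚ :- k :* l)) refl (κ j) K (λs j))) ⟩
      1ℚ - sumℚ (λ j → κ j * (1ℚ - K * λs j))
        ≡⟨ cong (_-_ 1ℚ) (sym (trans (dot-lin y κ Ww) (sum-cong (λ j → cong (κ j *_) (trans (dot-comm y (Ww j)) (W·y j)))))) ⟩
      1ℚ - dot y (λ c → sumℚ (λ j → κ j * Ww j c))
        ≡⟨ cong (_-_ 1ℚ) (trans (dot-comm y (λ c → sumℚ (λ j → κ j * Ww j c))) (sym (sum-cong (λ c → cong (_* y c) (x-rep c))))) ⟩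
      1ℚ - dot x y                               ∎

  dual-is-lattice : DualIsLatticePolytope V
  dual-is-lattice = suc d' , W , λ x → mk⇔ (dual⇒conv x) (conv⇒dual x)

  -- The origin is interior: with B = Σ_i Σ_c |W_ic| and ε = 1/(1+B), every
  -- x with |x_c| ≤ ε has x · W_i ≤ 1, so its coefficients (1 - x·W_i)/n
  -- with respect to V are non-negative.
  ‖W‖ : Fin (suc d') → ℚ
  ‖W‖ i = sumℚ (λ c → absq (W i c))

  B : ℚ
  B = sumℚ ‖W‖

  ‖W‖≥0 : ∀ i → 0ℚ ≤ ‖W‖ i
  ‖W‖≥0 i = sum-nonneg (λ c → absq (W i c)) (λ c → 0≤ℕ ℤ.∣ W i c ∣)

  B≥0 : 0ℚ ≤ B
  B≥0 = sum-nonneg ‖W‖ ‖W‖≥0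

  1+B>0 : 0ℚ < 1ℚ + B
  1+B>0 = ℚP.<-≤-trans {0ℚ} {1ℚ} (ℚ.*<* (ℤ.+<+ (ℕ.s≤s ℕ.z≤n))) (≤-via (solve 1 (λ b → b := con 1ℚ :+ b :- con 1ℚ) refl B) B≥0)

  instance
    1+B≢0 : ℚ.NonZero (1ℚ + B)
    1+B≢0 = ℚP.pos⇒nonZero (1ℚ + B) {{ℚ.positive 1+B>0}}

  ε : ℚ
  ε = ℚ.1/ (1ℚ + B)

  ε>0 : 0ℚ < ε
  ε>0 = ℚP.positive⁻¹ ε {{ℚP.1/pos⇒pos (1ℚ + B) {{ℚ.positive 1+B>0}}}}

  Bε≤1 : B * ε ≤ 1ℚ
  Bε≤1 = ≤-via (begin
    ε                               ≡⟨ solve 2 (λ b e → e := e :* (con 1ℚ :+ b) :- b :* e) refl B ε ⟩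
    ε * (1ℚ + B) - B * ε            ≡⟨ cong (_- B * ε) (ℚP.*-inverseˡ (1ℚ + B)) ⟩
    1ℚ - B * ε                      ∎) (ℚP.<⇒≤ ε>0)

  box⇒W·x≤1 : ∀ (x : Point d') → (∀ c → (- ε) ≤ x c × x c ≤ ε) → ∀ i → dot x (Ww i) ≤ 1ℚ
  box⇒W·x≤1 x box i =
    ℚP.≤-trans (ℚP.≤-reflexive (dot-comm x (Ww i)))
    (ℚP.≤-trans (sum-mono (λ c → Ww i c * x c) (λ c → absq (W i c) * ε)
                          (λ c → absbound (W i c) (proj₁ (box c)) (proj₂ (box c))))
    (ℚP.≤-trans (ℚP.≤-reflexive (sum-*r ε (λ c → absq (W i c))))
    (ℚP.≤-trans (ℚP.*-monoʳ-≤-nonNeg ε {{ℚ.nonNegative (ℚP.<⇒≤ ε>0)}}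
                  (term≤sum ‖W‖ ‖W‖≥0 i))
    Bε≤1)))

  origin-interior : OriginInInterior V
  origin-interior = ε , ε>0 , λ x box →
    scaled-InConv V (λ i → 1ℚ - dot x (Ww i)) x
      (λ i → ≤⇒0≤- (box⇒W·x≤1 x box i)) (sum-1-dot Ww W-sum x) (V-expansion x)

  reflexive : IsReflexive V
  reflexive = origin-interior , dual-is-lattice

-- Primitive multiples of rational vectors

common-denominator : ∀ {d} (w : Fin d → ℚ) → Σ ℕ (λ D' → ∀ c → IsInt (ℕtoℚ (suc D') * w c))
common-denominator {zero} w = 0 , λ ()
common-denominator {suc d} w = ℕ.pred (q ℕ.* D₀) , clear
  where
  rec : Σ ℕ (λ D' → ∀ c → IsInt (ℕtoℚ (suc D') * w (suc c)))
  rec = common-denominator (λ i → w (suc i))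
  D₀ q : ℕ
  D₀ = suc (proj₁ rec)
  q = ↧ₙ (w zero)
  clear : ∀ c → IsInt (ℕtoℚ (q ℕ.* D₀) * w c)
  clear zero = + D₀ ℤ.* ↥ (w zero) , (begin
    ℕtoℚ (q ℕ.* D₀) * w zero      ≡⟨ cong (_* w zero) (ℕtoℚ-* q D₀) ⟩
    ℕtoℚ q * ℕtoℚ D₀ * w zero     ≡⟨ solve 3 (λ a b c → a :* b :* c := b :* (c :* a)) refl (ℕtoℚ q) (ℕtoℚ D₀) (w zero) ⟩
    ℕtoℚ D₀ * (w zero * ℕtoℚ q)   ≡⟨ cong (ℕtoℚ D₀ *_) (*-denominator (w zero)) ⟩
    ℕtoℚ D₀ * toℚ (↥ (w zero))    ≡⟨ sym (toℚ-* (+ D₀) (↥ (w zero))) ⟩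
    toℚ (+ D₀ ℤ.* ↥ (w zero))     ∎)
  clear (suc c) = + q ℤ.* proj₁ (proj₂ rec c) , (begin
    ℕtoℚ (q ℕ.* D₀) * w (suc c)     ≡⟨ cong (_* w (suc c)) (ℕtoℚ-* q D₀) ⟩
    ℕtoℚ q * ℕtoℚ D₀ * w (suc c)    ≡⟨ ℚP.*-assoc (ℕtoℚ q) (ℕtoℚ D₀) (w (suc c)) ⟩
    ℕtoℚ q * (ℕtoℚ D₀ * w (suc c))  ≡⟨ cong (ℕtoℚ q *_) (proj₂ (proj₂ rec c)) ⟩
    ℕtoℚ q * toℚ (proj₁ (proj₂ rec c))  ≡⟨ sym (toℚ-* (+ q) (proj₁ (proj₂ rec c))) ⟩
    toℚ (+ q ℤ.* proj₁ (proj₂ rec c)) ∎)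

gcdⱽ : ∀ {d} → (Fin d → ℤ) → ℕ
gcdⱽ {zero} z = 0
gcdⱽ {suc d} z = ℕG.gcd ℤ.∣ z zero ∣ (gcdⱽ (λ i → z (suc i)))

gcdⱽ-divides : ∀ {d} (z : Fin d → ℤ) c → gcdⱽ z ℕD.∣ ℤ.∣ z c ∣
gcdⱽ-divides {suc d} z zero = ℕG.gcd[m,n]∣m ℤ.∣ z zero ∣ (gcdⱽ (λ i → z (suc i)))
gcdⱽ-divides {suc d} z (suc c) =
  ℕD.∣-trans (ℕG.gcd[m,n]∣n ℤ.∣ z zero ∣ (gcdⱽ (λ i → z (suc i)))) (gcdⱽ-divides (λ i → z (suc i)) c)

gcdⱽ-greatest : ∀ {d} (z : Fin d → ℤ) e → (∀ c → e ℕD.∣ ℤ.∣ z c ∣) → e ℕD.∣ gcdⱽ z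
gcdⱽ-greatest {zero} z e h = e ℕD.∣0
gcdⱽ-greatest {suc d} z e h = ℕG.gcd-greatest (h zero) (gcdⱽ-greatest (λ i → z (suc i)) e (λ i → h (suc i)))

no-integer-in-0-1 : ∀ p → 0ℚ < canon p → canon p < 1ℚ → ⊥
no-integer-in-0-1 (+ zero) (ℚ.*<* (ℤ.+<+ ())) _
no-integer-in-0-1 (+ suc n) _ (ℚ.*<* (ℤ.+<+ (ℕ.s≤s ())))
no-integer-in-0-1 -[1+ n ] (ℚ.*<* ()) _

record PrimitiveMultiple {d : ℕ} (w : Fin d → ℚ) : Set where
  field
    t : ℚ
    t≥0 : 0ℚ ≤ t
    isPrimitive : IsPrimitive (λ c → t * w c)

-- Every non-zero rational vector has a primitive multiple: clear
-- denominators (D w = z integral) and divide by g = gcd(z); t = D/g.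
primitive-multiple : ∀ {d} (w : Fin d → ℚ) → ¬ (∀ c → w c ≡ 0ℚ) → PrimitiveMultiple w
primitive-multiple {d} w w≢0 = record
  { t = t
  ; t≥0 = 0≤* (0≤ℕ D) (recip-nonneg g')
  ; isPrimitive = (λ c → a c , sym (a≡tw c))
              , λ s s>0 s<1 lat → primitive-a s s>0 s<1 λ c → proj₁ (lat c) , trans (cong (s *_) (a≡tw c)) (proj₂ (lat c))
  }
  where
  D' D : ℕ
  D' = proj₁ (common-denominator w)
  D = suc D'
  z : Fin d → ℤ
  z c = proj₁ (proj₂ (common-denominator w) c)
  Dw≡z : ∀ c → ℕtoℚ D * w c ≡ toℚ (z c)
  Dw≡z c = proj₂ (proj₂ (common-denominator w) c)
  g : ℕ
  g = gcdⱽ z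

  -- g ≠ 0, since otherwise z = 0 and hence w = 0.
  g≡suc : Σ ℕ (λ g' → g ≡ suc g')
  g≡suc with g in eq
  ... | suc g' = g' , refl
  ... | zero = ⊥-elim (w≢0 λ c → suc-cancel D' (trans (Dw≡z c) (cong toℚ (z≡0 c))))
    where
    z≡0 : ∀ c → z c ≡ + 0
    z≡0 c = ℤP.∣i∣≡0⇒i≡0 (ℕD.0∣⇒≡0 (subst (ℕD._∣ ℤ.∣ z c ∣) eq (gcdⱽ-divides z c)))
  g' : ℕ
  g' = proj₁ g≡suc

  g∣z : ∀ c → (+ g) ℤS.∣ z c
  g∣z c = ℤS.∣ᵤ⇒∣ {+ g} {z c} (gcdⱽ-divides z c)
  a : Fin d → ℤ
  a c = ℤS._∣_.quotient (g∣z c)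
  z≡ag : ∀ c → z c ≡ a c ℤ.* + g
  z≡ag c = ℤS._∣_.equality (g∣z c)
  t : ℚ
  t = ℕtoℚ D * recip g'
  a≡tw : ∀ c → toℚ (a c) ≡ t * w c
  a≡tw c = begin
    toℚ (a c)                                   ≡⟨ sym (trans (cong (toℚ (a c) *_) (recip-inverse g')) (ℚP.*-identityʳ (toℚ (a c)))) ⟩
    toℚ (a c) * (ℕtoℚ (suc g') * recip g')      ≡⟨ sym (ℚP.*-assoc (toℚ (a c)) (ℕtoℚ (suc g')) (recip g')) ⟩
    toℚ (a c) * ℕtoℚ (suc g') * recip g'        ≡⟨ cong (_* recip g') (sym (toℚ-* (a c) (+ suc g'))) ⟩
    toℚ (a c ℤ.* + suc g') * recip g'           ≡⟨ cong (λ e → toℚ (a c ℤ.* + e) * recip g') (sym (proj₂ g≡suc)) ⟩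
    toℚ (a c ℤ.* + g) * recip g'                ≡⟨ cong (λ e → toℚ e * recip g') (sym (z≡ag c)) ⟩
    toℚ (z c) * recip g'                        ≡⟨ cong (_* recip g') (sym (Dw≡z c)) ⟩
    ℕtoℚ D * w c * recip g'                     ≡⟨ solve 3 (λ x y z → x :* y :* z := x :* z :* y) refl (ℕtoℚ D) (w c) (recip g') ⟩
    t * w c                                     ∎

  -- If s a were integral for s = p/q ∈ (0,1) in lowest terms, q would
  -- divide every a_c, so q g would divide gcd z = g: q = 1, contradiction.
  primitive-a : ∀ (s : ℚ) → 0ℚ < s → s < 1ℚ → ¬ IsLatticePoint (λ c → s * toℚ (a c))
  primitive-a s@(mkℚ p q-1 cop) s>0 s<1 lat =
    no-integer-in-0-1 p (subst (0ℚ <_) s≡p s>0) (subst (_< 1ℚ) s≡p s<1)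
    where
    q : ℕ
    q = suc q-1
    y : Fin d → ℤ
    y c = proj₁ (lat c)
    pa≡qy : ∀ c → p ℤ.* a c ≡ + q ℤ.* y c
    pa≡qy c = toℚ-inj (begin
      toℚ (p ℤ.* a c)              ≡⟨ toℚ-* p (a c) ⟩
      toℚ p * toℚ (a c)            ≡⟨ cong (_* toℚ (a c)) (sym (*-denominator s)) ⟩
      s * ℕtoℚ q * toℚ (a c)       ≡⟨ solve 3 (λ x y z → x :* y :* z := y :* (x :* z)) refl s (ℕtoℚ q) (toℚ (a c)) ⟩
      ℕtoℚ q * (s * toℚ (a c))     ≡⟨ cong (ℕtoℚ q *_) (proj₂ (lat c)) ⟩
      ℕtoℚ q * toℚ (y c)           ≡⟨ sym (toℚ-* (+ q) (y c)) ⟩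
      toℚ (+ q ℤ.* y c)            ∎)
    q∣a : ∀ c → q ℕD.∣ ℤ.∣ a c ∣
    q∣a c = ℕC.coprime-divisor (ℕC.sym (ℕC.recompute cop))
              (ℕD.divides ℤ.∣ y c ∣ (trans (sym (ℤP.abs-* p (a c))) (trans (cong ℤ.∣_∣ (pa≡qy c))
                 (trans (ℤP.abs-* (+ q) (y c)) (ℕP.*-comm q ℤ.∣ y c ∣)))))
    qg∣z : ∀ c → q ℕ.* g ℕD.∣ ℤ.∣ z c ∣
    qg∣z c = subst (q ℕ.* g ℕD.∣_) (sym (trans (cong ℤ.∣_∣ (z≡ag c)) (ℤP.abs-* (a c) (+ g)))) (ℕD.*-monoˡ-∣ g (q∣a c))
    q∣1 : q ℕD.∣ 1
    q∣1 = ℕD.*-cancelʳ-∣ (suc g') (subst (λ e → q ℕ.* e ℕD.∣ 1 ℕ.* e) (proj₂ g≡suc)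
            (subst (q ℕ.* g ℕD.∣_) (sym (ℕP.*-identityˡ g)) (gcdⱽ-greatest z (q ℕ.* g) qg∣z)))
    s≡p : s ≡ canon p
    s≡p = ℚ-ext s (canon p) refl (ℕD.∣1⇒≡1 q∣1)

-- Facet normals of T_H

module FacetNormals {d : ℕ} (H : Graph (suc d)) (solve-L : Solvable H) where

  K : ℚ
  K = ℕtoℚ (suc d)

  V : Fin (suc d) → Fin d → ℤ
  V = laplacianSimplex H

  potential : Fin (suc d) → Fin (suc d) → ℚ
  potential j = proj₁ (solve-L (facetVector j) (facetVector-sum j))

  û : Fin (suc d) → Fin (suc d) → ℚ
  û j k = potential j k - potential j (fromℕ d)

  L-û : ∀ j i → Lu H (û j) i ≡ facetVector j i
  L-û j i = trans (Lu-shift H (potential j) (potential j (fromℕ d)) i)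
                  (proj₂ (solve-L (facetVector j) (facetVector-sum j)) i)

  normal : Fin (suc d) → Point d
  normal j = Du (û j)

  normal·V : ∀ j i → dot (normal j) (embed (V i)) ≡ 1ℚ - K * δ i j
  normal·V j i = trans (dot-congʳ (normal j) (Vq-embed H i)) (trans (Du-dot H (û j) i) (L-û j i))

  -- û_j is recovered from w_j through A, since û_j(last) = 0.
  û-from-normal : ∀ j k → û j k ≡ sumℚ (λ c → Aq k c * normal j c)
  û-from-normal j k = sym (begin
    sumℚ (λ c → Aq k c * normal j c)         ≡⟨ telescope d (û j) k ⟩
    û j k - û j (fromℕ d)                    ≡⟨ cong (_-_ (û j k)) (ℚP.+-inverseʳ (potential j (fromℕ d))) ⟩
    û j k - 0ℚ                               ≡⟨ solve 1 (λ x → x :- con 0ℚ := x) refl (û j k) ⟩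
    û j k                                    ∎)

  normal·hull : ∀ j x ((λs , _ , λ-sum , x-rep) : InConv V x) → dot (normal j) x ≡ 1ℚ - K * λs j
  normal·hull j x (λs , _ , λ-sum , x-rep) = begin
    dot (normal j) x                                          ≡⟨ dot-congʳ (normal j) x-rep ⟩
    dot (normal j) (λ c → sumℚ (λ i → λs i * embed (V i) c))  ≡⟨ dot-lin (normal j) λs (λ i → embed (V i)) ⟩
    sumℚ (λ i → λs i * dot (normal j) (embed (V i)))          ≡⟨ sum-cong (λ i → cong (λs i *_) (normal·V j i)) ⟩
    sumℚ (λ i → λs i * (1ℚ - K * δ i j))                      ≡⟨ sum-1-Kδ K λs j ⟩
    sumℚ λs - K * λs j                                        ≡⟨ cong (_- K * λs j) λ-sum ⟩
    1ℚ - K * λs j                                             ∎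

  -- With d ≥ 1 the normals are non-zero: w_j · V_j = 1 - n ≠ 0.
  normal≢0 : 1 ℕ.≤ d → ∀ j → ¬ (∀ c → normal j c ≡ 0ℚ)
  normal≢0 d≥1 j normal≡0 = ℕP.<⇒≢ d≥1 (sym (ℕP.suc-injective (ℤP.+-injective (toℚ-inj K≡1))))
    where
    K-1≡0 : K - 1ℚ ≡ 0ℚ
    K-1≡0 = begin
      K - 1ℚ                               ≡⟨ solve 1 (λ k → k :- con 1ℚ := con 0ℚ :- (con 1ℚ :- k :* con 1ℚ)) refl K ⟩
      0ℚ - (1ℚ - K * 1ℚ)                   ≡⟨ cong (λ e → 0ℚ - (1ℚ - K * e)) (sym (δ-refl j)) ⟩
      0ℚ - (1ℚ - K * δ j j)                ≡⟨ cong (_-_ 0ℚ) (sym (normal·V j j)) ⟩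
      0ℚ - dot (normal j) (embed (V j))
        ≡⟨ cong (_-_ 0ℚ) (trans (dot-comm (normal j) (embed (V j))) (dot-zeroʳ (embed (V j)) (normal j) normal≡0)) ⟩
      0ℚ - 0ℚ                              ≡⟨ ℚP.+-inverseʳ 0ℚ ⟩
      0ℚ                                   ∎
    K≡1 : toℚ (+ suc d) ≡ toℚ (+ 1)
    K≡1 = a-b≡0⇒a≡b K-1≡0

  facet : ∀ j (t : ℚ) → 0ℚ ≤ t → IsFacetHyperplane V (λ c → t * normal j c) t
  facet j t t≥0 = valid , p , (λ r → generator-InConv V (punchIn j r)) , on-facet , independent
    where
    valid : ∀ x → InConv V x → dot (λ c → t * normal j c) x ≤ t
    valid x x∈T@(λs , λ≥0 , _) = ≤-via (begin
      t * (K * λs j)                        ≡⟨ solve 3 (λ t k l → t :* (k :* l) := t :- t :* (con 1ℚ :- k :* l)) refl t K (λs j) ⟩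
      t - t * (1ℚ - K * λs j)               ≡⟨ cong (λ e → t - t * e) (sym (normal·hull j x x∈T)) ⟩
      t - t * dot (normal j) x              ≡⟨ cong (_-_ t) (sym (dot-scal t (normal j) x)) ⟩
      t - dot (λ c → t * normal j c) x      ∎) (0≤* t≥0 (0≤* (0≤ℕ (suc d)) (λ≥0 j)))
    p : Fin d → Point d
    p r = embed (V (punchIn j r))
    on-facet : ∀ r → dot (λ c → t * normal j c) (p r) ≡ t
    on-facet r = begin
      dot (λ c → t * normal j c) (p r)       ≡⟨ dot-scal t (normal j) (p r) ⟩
      t * dot (normal j) (p r)               ≡⟨ cong (t *_) (normal·V j (punchIn j r)) ⟩
      t * (1ℚ - K * δ (punchIn j r) j)       ≡⟨ cong (λ e → t * (1ℚ - K * e)) (δ-no (FinP.punchInᵢ≢i j r)) ⟩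
      t * (1ℚ - K * 0ℚ)                      ≡⟨ solve 2 (λ t k → t :* (con 1ℚ :- k :* con 0ℚ) := t) refl t K ⟩
      t                                      ∎
    -- Pairing Σ_r μ_r p_r = 0 with w_{j'}, j' the r0-th vertex other
    -- than j, gives Σ μ - n μ_r0 = 0, i.e. μ_r0 = 0.
    independent : AffinelyIndependent p
    independent μ μ-sum μp≡0 r0 = suc-cancel d (begin
      K * μ r0                                  ≡⟨ solve 2 (λ k m → k :* m := con 0ℚ :- (con 0ℚ :- k :* m)) refl K (μ r0) ⟩
      0ℚ - (0ℚ - K * μ r0)                      ≡⟨ cong (λ e → 0ℚ - (e - K * μ r0)) (sym μ-sum) ⟩
      0ℚ - (sumℚ μ - K * μ r0)                  ≡⟨ cong (_-_ 0ℚ) (sym (sum-1-Kδ K μ r0)) ⟩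
      0ℚ - sumℚ (λ r → μ r * (1ℚ - K * δ r r0))
        ≡⟨ cong (_-_ 0ℚ) (sum-cong (λ r → cong (μ r *_) (sym (trans (normal·V j' (punchIn j r))
                                         (cong (λ e → 1ℚ - K * e) (δ-inj (punchIn j) (FinP.punchIn-injective j _ _) r r0)))))) ⟩
      0ℚ - sumℚ (λ r → μ r * dot (normal j') (p r))
        ≡⟨ cong (_-_ 0ℚ) (sym (dot-lin (normal j') μ p)) ⟩
      0ℚ - dot (normal j') (λ c → sumℚ (λ r → μ r * p r c))
        ≡⟨ cong (_-_ 0ℚ) (dot-zeroʳ (normal j') (λ c → sumℚ (λ r → μ r * p r c)) μp≡0) ⟩
      0ℚ - 0ℚ                                   ≡⟨ ℚP.+-inverseʳ 0ℚ ⟩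
      0ℚ                                        ∎)
      where
      j' : Fin (suc d)
      j' = punchIn j r0

-- Integral potentials

IntegralPotentials : ∀ {d} → Graph (suc d) → ℚ → Set
IntegralPotentials {d} H s =
  ∀ j → Σ (Fin (suc d) → ℚ) λ u → (∀ k → IsInt (u k)) × (∀ i → Lu H u i ≡ s * facetVector j i)

potentials⇒reflexive : ∀ {d} (H : Graph (suc d)) → Spans (Vq H) → IntegralPotentials H 1ℚ →
  IsReflexive (laplacianSimplex H)
potentials⇒reflexive {d} H spans potentials = ReflexivityCriterion.reflexive V W V-sum V-spans W·V
  where
  V : Fin (suc d) → Fin d → ℤ
  V = laplacianSimplex H
  u : Fin (suc d) → Fin (suc d) → ℚ
  u j = proj₁ (potentials j)
  Du-int : ∀ j c → IsInt (Du (u j) c)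
  Du-int j c = int-- (proj₁ (proj₂ (potentials j)) (inject₁ c)) (proj₁ (proj₂ (potentials j)) (suc c))
  W : Fin (suc d) → Fin d → ℤ
  W j c = proj₁ (Du-int j c)
  V-sum : ∀ c → sumℚ (λ i → embed (V i) c) ≡ 0ℚ
  V-sum c = trans (sum-cong (λ i → Vq-embed H i c)) (Vq-sum H c)
  V-spans : Spans (λ i → embed (V i))
  V-spans = Spans-cong (λ i c → sym (Vq-embed H i c)) spans
  W·V : ∀ j i → dot (embed (W j)) (embed (V i)) ≡ facetVector j i
  W·V j i = begin
    dot (embed (W j)) (embed (V i))     ≡⟨ sum-cong (λ c → cong₂ _*_ (sym (proj₂ (Du-int j c))) (Vq-embed H i c)) ⟩
    dot (Du (u j)) (Vq H i)             ≡⟨ Du-dot H (u j) i ⟩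
    Lu H (u j) i                        ≡⟨ proj₂ (proj₂ (potentials j)) i ⟩
    1ℚ * facetVector j i                ≡⟨ ℚP.*-identityˡ (facetVector j i) ⟩
    facetVector j i                     ∎

two : ℚ
two = ℕtoℚ 2

-- If T_H is 2-reflexive, the primitive multiple t w_j of each facet normal
-- gives the facet opposite V_j at lattice distance t, so t = 2 and 2 w_j is
-- integral; then U_j = 2 û_j = A (2 w_j) is an integral potential of weight 2.
two-reflexive⇒potentials : ∀ {d} (H : Graph (suc d)) → 1 ℕ.≤ d → Solvable H →
  IsLReflexive (laplacianSimplex H) 2 → IntegralPotentials H two
two-reflexive⇒potentials {d} H d≥1 solve-L (_ , _ , facet-distance) j = U , U-int , L-U
  where
  open FacetNormals H solve-L
  open PrimitiveMultiple (primitive-multiple (normal j) (normal≢0 d≥1 j))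
  t≡2 : t ≡ two
  t≡2 = facet-distance (λ c → t * normal j c) t isPrimitive (facet j t t≥0)
  2w-int : ∀ c → IsInt (two * normal j c)
  2w-int c = proj₁ (proj₁ isPrimitive c) , trans (cong (_* normal j c) (sym t≡2)) (proj₂ (proj₁ isPrimitive c))
  U : Fin (suc d) → ℚ
  U k = two * û j k
  U-int : ∀ k → IsInt (U k)
  U-int k = subst IsInt (sym U≡A2w) (int-sum (λ c → Aq k c * (two * normal j c)) (λ c → int-* (int-bq (toℕ k ≤ᵇ toℕ c)) (2w-int c)))
    where
    U≡A2w : U k ≡ sumℚ (λ c → Aq k c * (two * normal j c))
    U≡A2w = trans (cong (two *_) (û-from-normal j k)) (trans (sym (sum-*l two (λ c → Aq k c * normal j c)))
              (sum-cong (λ c → solve 3 (λ t a w → t :* (a :* w) := a :* (t :* w)) refl two (Aq k c) (normal j c))))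
  L-U : ∀ i → Lu H U i ≡ two * facetVector j i
  L-U i = trans (Lu-scale H two (û j) i) (cong (two *_) (L-û j i))

-- The whiskered graph

module Whiskered {n : ℕ} (G : Graph n) where
  -- Vertices x_i = i ↑ˡ n and y_i = n ↑ʳ i of W(G).

  WG : Graph (n ℕ.+ n)
  WG = whisker G

  adj-xx : ∀ i k → adj WG (i ↑ˡ n) (k ↑ˡ n) ≡ adj G i k
  adj-xx i k rewrite FinP.splitAt-↑ˡ n i n | FinP.splitAt-↑ˡ n k n = refl

  adj-xy : ∀ i k → adj WG (i ↑ˡ n) (n ↑ʳ k) ≡ ⌊ i ≟ k ⌋
  adj-xy i k rewrite FinP.splitAt-↑ˡ n i n | FinP.splitAt-↑ʳ n n k = refl

  adj-yx : ∀ i k → adj WG (n ↑ʳ i) (k ↑ˡ n) ≡ ⌊ i ≟ k ⌋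
  adj-yx i k rewrite FinP.splitAt-↑ʳ n n i | FinP.splitAt-↑ˡ n k n = refl

  adj-yy : ∀ i k → adj WG (n ↑ʳ i) (n ↑ʳ k) ≡ false
  adj-yy i k rewrite FinP.splitAt-↑ʳ n n i | FinP.splitAt-↑ʳ n n k = refl

  vertex-cases : ∀ {P : Fin (n ℕ.+ n) → Set} → (∀ i → P (i ↑ˡ n)) → (∀ i → P (n ↑ʳ i)) → ∀ v → P v
  vertex-cases {P} hx hy v with splitAt n v in eq
  ... | inj₁ i = subst P (FinP.splitAt⁻¹-↑ˡ eq) (hx i)
  ... | inj₂ i = subst P (FinP.splitAt⁻¹-↑ʳ eq) (hy i)

  base : Fin (n ℕ.+ n) → Fin n
  base v = [ (λ i → i) , (λ i → i) ]′ (splitAt n v)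

  base-x : ∀ k → base (k ↑ˡ n) ≡ k
  base-x k = cong [ (λ i → i) , (λ i → i) ]′ (FinP.splitAt-↑ˡ n k n)

  base-y : ∀ k → base (n ↑ʳ k) ≡ k
  base-y k = cong [ (λ i → i) , (λ i → i) ]′ (FinP.splitAt-↑ʳ n n k)

  x≢y : ∀ (i k : Fin n) → i ↑ˡ n ≢ n ↑ʳ k
  x≢y i k e with trans (sym (FinP.splitAt-↑ˡ n i n)) (trans (cong (splitAt n) e) (FinP.splitAt-↑ʳ n n k))
  ... | ()

  δ-base : ∀ (i : Fin n) v → δ i (base v) ≡ δ (i ↑ˡ n) v + δ (n ↑ʳ i) v
  δ-base i = vertex-cases {λ v → δ i (base v) ≡ δ (i ↑ˡ n) v + δ (n ↑ʳ i) v}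
    (λ k → begin
      δ i (base (k ↑ˡ n))                     ≡⟨ cong (δ i) (base-x k) ⟩
      δ i k                                   ≡⟨ sym (ℚP.+-identityʳ (δ i k)) ⟩
      δ i k + 0ℚ                              ≡⟨ cong₂ _+_ (sym (δ-inj (_↑ˡ n) (FinP.↑ˡ-injective n _ _) i k))
                                                            (sym (δ-no (λ e → x≢y k i (sym e)))) ⟩
      δ (i ↑ˡ n) (k ↑ˡ n) + δ (n ↑ʳ i) (k ↑ˡ n)  ∎)
    (λ k → begin
      δ i (base (n ↑ʳ k))                     ≡⟨ cong (δ i) (base-y k) ⟩
      δ i k                                   ≡⟨ sym (ℚP.+-identityˡ (δ i k)) ⟩
      0ℚ + δ i k                              ≡⟨ cong₂ _+_ (sym (δ-no (x≢y i k))) (sym (δ-inj (n ↑ʳ_) (FinP.↑ʳ-injective n _ _) i k)) ⟩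
      δ (i ↑ˡ n) (n ↑ʳ k) + δ (n ↑ʳ i) (n ↑ʳ k)  ∎)

  extend : (s r : Fin n → ℚ) → Fin (n ℕ.+ n) → ℚ
  extend s r v = [ s , (λ i → s i + r i) ]′ (splitAt n v)

  extend-x : ∀ s r i → extend s r (i ↑ˡ n) ≡ s i
  extend-x s r i = cong [ s , (λ i → s i + r i) ]′ (FinP.splitAt-↑ˡ n i n)

  extend-y : ∀ s r i → extend s r (n ↑ʳ i) ≡ s i + r i
  extend-y s r i = cong [ s , (λ i → s i + r i) ]′ (FinP.splitAt-↑ʳ n n i)

  L-extend-x : ∀ s r i → Lu WG (extend s r) (i ↑ˡ n) ≡ Lu G s i - r i
  L-extend-x s r i = begin
    Lu WG u (i ↑ˡ n)
      ≡⟨ Lu-formula WG u (i ↑ˡ n) ⟩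
    sumℚ (λ w → adjq WG (i ↑ˡ n) w * (u (i ↑ˡ n) - u w))
      ≡⟨ sum-split n (λ w → adjq WG (i ↑ˡ n) w * (u (i ↑ˡ n) - u w)) ⟩
    sumℚ (λ k → adjq WG (i ↑ˡ n) (k ↑ˡ n) * (u (i ↑ˡ n) - u (k ↑ˡ n)))
      + sumℚ (λ k → adjq WG (i ↑ˡ n) (n ↑ʳ k) * (u (i ↑ˡ n) - u (n ↑ʳ k)))
      ≡⟨ cong₂ _+_ (sum-cong (λ k → cong₂ (λ a b → bq a * b) (adj-xx i k) (cong₂ _-_ (extend-x s r i) (extend-x s r k))))
                   (sum-cong (λ k → cong₂ (λ a b → bq a * b) (adj-xy i k) (cong₂ _-_ (extend-x s r i) (extend-y s r k)))) ⟩
    sumℚ (λ k → adjq G i k * (s i - s k)) + sumℚ (λ k → δ i k * (s i - (s k + r k)))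
      ≡⟨ cong₂ _+_ (sym (Lu-formula G s i)) (sum-δ' i (λ k → s i - (s k + r k))) ⟩
    Lu G s i + (s i - (s i + r i))
      ≡⟨ solve 3 (λ l a b → l :+ (a :- (a :+ b)) := l :- b) refl (Lu G s i) (s i) (r i) ⟩
    Lu G s i - r i ∎
    where
    u : Fin (n ℕ.+ n) → ℚ
    u = extend s r

  L-extend-y : ∀ s r i → Lu WG (extend s r) (n ↑ʳ i) ≡ r i
  L-extend-y s r i = begin
    Lu WG u (n ↑ʳ i)
      ≡⟨ Lu-formula WG u (n ↑ʳ i) ⟩
    sumℚ (λ w → adjq WG (n ↑ʳ i) w * (u (n ↑ʳ i) - u w))
      ≡⟨ sum-split n (λ w → adjq WG (n ↑ʳ i) w * (u (n ↑ʳ i) - u w)) ⟩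
    sumℚ (λ k → adjq WG (n ↑ʳ i) (k ↑ˡ n) * (u (n ↑ʳ i) - u (k ↑ˡ n)))
      + sumℚ (λ k → adjq WG (n ↑ʳ i) (n ↑ʳ k) * (u (n ↑ʳ i) - u (n ↑ʳ k)))
      ≡⟨ cong₂ _+_ (sum-cong (λ k → cong₂ (λ a b → bq a * b) (adj-yx i k) (cong₂ _-_ (extend-y s r i) (extend-x s r k))))
                   (sum-cong (λ k → trans (cong (λ a → bq a * (u (n ↑ʳ i) - u (n ↑ʳ k))) (adj-yy i k))
                                          (ℚP.*-zeroˡ (u (n ↑ʳ i) - u (n ↑ʳ k))))) ⟩
    sumℚ (λ k → δ i k * (s i + r i - s k)) + sumℚ (λ (k : Fin n) → 0ℚ)
      ≡⟨ cong₂ _+_ (sum-δ' i (λ k → s i + r i - s k)) (sum-0 {n}) ⟩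
    s i + r i - s i + 0ℚ
      ≡⟨ solve 2 (λ a b → a :+ b :- a :+ con 0ℚ := b) refl (s i) (r i) ⟩
    r i ∎
    where
    u : Fin (n ℕ.+ n) → ℚ
    u = extend s r

  solve-extend : ∀ (s : Fin n → ℚ) (t : Fin (n ℕ.+ n) → ℚ) →
    (∀ i → Lu G s i ≡ t (i ↑ˡ n) + t (n ↑ʳ i)) → ∀ v → Lu WG (extend s (λ i → t (n ↑ʳ i))) v ≡ t v
  solve-extend s t hs = vertex-cases
    (λ i → trans (L-extend-x s r i) (trans (cong (_- r i) (hs i))
                 (solve 2 (λ a b → a :+ b :- b := a) refl (t (i ↑ˡ n)) (r i))))
    (λ i → L-extend-y s r i)
    where
    r : Fin n → ℚ
    r i = t (n ↑ʳ i)

module _ {d : ℕ} (G : Graph (suc d)) where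
  open Whiskered G

  -- Solvability passes to W(G): fold t onto G via t_{x_i} + t_{y_i}.
  whisker-solvable : Solvable G → Solvable (whisker G)
  whisker-solvable solve-G t t-sum = extend s (λ i → t (suc d ↑ʳ i)) , solve-extend s t (proj₂ solution)
    where
    t-x t-y t-folded : Fin (suc d) → ℚ
    t-x i = t (i ↑ˡ suc d)
    t-y i = t (suc d ↑ʳ i)
    t-folded i = t-x i + t-y i
    solution : Σ (Fin (suc d) → ℚ) λ s → ∀ k → Lu G s k ≡ t-folded k
    solution = solve-G t-folded (begin
      sumℚ t-folded               ≡⟨ sum-+ t-x t-y ⟩
      sumℚ t-x + sumℚ t-y         ≡⟨ sym (sum-split {suc d} (suc d) t) ⟩
      sumℚ t                      ≡⟨ t-sum ⟩
      0ℚ                          ∎)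
    s : Fin (suc d) → ℚ
    s = proj₁ solution

  -- From weight-2 potentials U_j of G: the potential of a vertex v of W(G)
  -- extends U_{base v} by r_i = 1 - 2n δ_{y_i v}; it is integral, and its
  -- Laplacian is 1 - 2n e_v because 2 (1 - n e_{base v}) splits as the sum
  -- of the x- and y-parts of 1 - 2n e_v.
  whisker-potentials : IntegralPotentials G two → IntegralPotentials (whisker G) 1ℚ
  whisker-potentials potentials v = u , u-int , L-u
    where
    K N : ℚ
    K = ℕtoℚ (suc d)
    N = ℕtoℚ (suc d ℕ.+ suc d)
    N≡2K : N ≡ two * K
    N≡2K = trans (toℚ-+ (+ suc d) (+ suc d)) (solve 1 (λ k → k :+ k := con two :* k) refl K)
    t : Fin (suc d ℕ.+ suc d) → ℚ
    t = facetVector v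
    U : Fin (suc d) → ℚ
    U = proj₁ (potentials (base v))
    u : Fin (suc d ℕ.+ suc d) → ℚ
    u = extend U (λ i → t (suc d ↑ʳ i))
    L-U : ∀ i → Lu G U i ≡ t (i ↑ˡ suc d) + t (suc d ↑ʳ i)
    L-U i = begin
      Lu G U i                                                ≡⟨ proj₂ (proj₂ (potentials (base v))) i ⟩
      two * (1ℚ - K * δ i (base v))                           ≡⟨ cong (λ e → two * (1ℚ - K * e)) (δ-base i v) ⟩
      two * (1ℚ - K * (δ (i ↑ˡ suc d) v + δ (suc d ↑ʳ i) v))
        ≡⟨ solve 3 (λ k a b → con two :* (con 1ℚ :- k :* (a :+ b)) := (con 1ℚ :- (con two :* k) :* a) :+ (con 1ℚ :- (con two :* k) :* b))
                   refl K (δ (i ↑ˡ suc d) v) (δ (suc d ↑ʳ i) v) ⟩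
      (1ℚ - two * K * δ (i ↑ˡ suc d) v) + (1ℚ - two * K * δ (suc d ↑ʳ i) v)
        ≡⟨ cong (λ e → (1ℚ - e * δ (i ↑ˡ suc d) v) + (1ℚ - e * δ (suc d ↑ʳ i) v)) (sym N≡2K) ⟩
      t (i ↑ˡ suc d) + t (suc d ↑ʳ i)                         ∎
    L-u : ∀ w → Lu (whisker G) u w ≡ 1ℚ * t w
    L-u w = trans (solve-extend U t L-U w) (sym (ℚP.*-identityˡ (t w)))
    t-int : ∀ w → IsInt (t w)
    t-int w = int-- (+ 1 , refl) (int-* (+ (suc d ℕ.+ suc d) , refl) (int-δ w v))
    u-int : ∀ w → IsInt (u w)
    u-int = vertex-cases
      (λ i → subst IsInt (sym (extend-x U _ i)) (proj₁ (proj₂ (potentials (base v))) i))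
      (λ i → subst IsInt (sym (extend-y U _ i)) (int-+ (proj₁ (proj₂ (potentials (base v))) i) (t-int (suc d ↑ʳ i))))

proposition5p5 : (d : ℕ) → 1 ℕ.≤ d → (G : Graph (suc d)) → Connected G →
    IsLReflexive (laplacianSimplex G) 2 →
    IsReflexive (laplacianSimplex (whisker G))
proposition5p5 d d≥1 G _ two-reflexive =
  potentials⇒reflexive (whisker G) (solvable⇒spans (whisker G) (whisker-solvable G solve-G))
                       (whisker-potentials G (two-reflexive⇒potentials G d≥1 solve-G two-reflexive))
  where
  -- The origin is interior to T_G, so its vertices span and L_G is
  -- surjective onto vectors of sum 0.
  solve-G : Solvable G
  solve-G = spans⇒solvable G (Spans-cong (Vq-embed G) (interior⇒spans (laplacianSimplex G) (proj₁ two-reflexive)))
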